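{- Let $(\mathcal C,\otimes,I,\gamma)$ be a symmetric monoidal category and $(\mathcal T,\eta,\mu,\tau)$ a strong monad on it. The following are equivalent: (1) for every object $X$ of $\mathcal C$, $\mathcal T$ admits a terminal central cone at $X$; (2) there exists a commutative strong submonad $\mathcal Z$ of $\mathcal T$, with submonad monomorphism $\iota:\mathcal Z\Rightarrow\mathcal T$, such that the canonical embedding $\mathcal I:\mathcal C_{\mathcal Z}\to\mathcal C_{\mathcal T}$ ($\mathcal I(X)=X$, $\mathcal I(f:X\to\mathcal ZY)=\iota_Y\circ f$) corestricts to an isomorphism of categories $\mathcal C_{\mathcal Z}\cong Z(\mathcal C_{\mathcal T})$; (3) the corestriction $\hat{\mathcal J}:\mathcal C\to Z(\mathcal C_{\mathcal T})$ of the Kleisli left adjoint $\mathcal J:\mathcal C\to\mathcal C_{\mathcal T}$ to the premonoidal centre is a left adjoint.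
   Context: Right strength: $\tau'_{X,Y}=\mathcal T(\gamma_{Y,X})\circ\tau_{Y,X}\circ\gamma_{\mathcal TX,Y}$. A strong monad is commutative if $\mu_{X\otimes Y}\circ\mathcal T\tau'_{X,Y}\circ\tau_{\mathcal TX,Y}=\mu_{X\otimes Y}\circ\mathcal T\tau_{X,Y}\circ\tau'_{X,\mathcal TY}$ for all $X,Y$. A central cone of $\mathcal T$ at $X$ is a pair $(Z,\iota)$ with $\iota:Z\to\mathcal TX$ such that for every object $Y$, $\mu_{X\otimes Y}\circ\mathcal T\tau'_{X,Y}\circ\tau_{\mathcal TX,Y}\circ(\iota\otimes\mathrm{id}_{\mathcal TY})=\mu_{X\otimes Y}\circ\mathcal T\tau_{X,Y}\circ\tau'_{X,\mathcal TY}\circ(\iota\otimes\mathrm{id}_{\mathcal TY})$; morphisms of central cones $(Z',\iota')\to(Z,\iota)$ are $\varphi:Z'\to Z$ with $\iota\circ\varphi=\iota'$; a terminal central cone is a terminal object of this category. A strong submonad of $\mathcal T$ is a strong monad $\mathcal Z$ with a monomorphism of strong monads $\iota:\mathcal Z\Rightarrow\mathcal T$ (natural transformation with $\iota\circ\eta^{\mathcal Z}=\eta^{\mathcal T}$, $\iota\circ\mu^{\mathcal Z}=\mu^{\mathcal T}\circ\mathcal T\iota\circ\iota_{\mathcal Z}$, $\iota_{X\otimes Y}\circ\tau^{\mathcal Z}_{X,Y}=\tau^{\mathcal T}_{X,Y}\circ(X\otimes\iota_Y)$). Kleisli category $\mathcal C_{\mathcal T}$: morphisms $X\to Y$ are morphisms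 $X\to\mathcal TY$, composition $g\odot f=\mu\circ\mathcal Tg\circ f$, identities $\eta$; the Kleisli left adjoint $\mathcal J$ is the identity on objects and sends $f$ to $\eta\circ f$. For $f:X\to\mathcal TY$ and object $W$: $f\otimes_l W=\tau'_{Y,W}\circ(f\otimes W)$, $W\otimes_r f=\tau_{W,Y}\circ(W\otimes f)$. A Kleisli morphism $f:X\to\mathcal TY$ is central if for all $f':X'\to\mathcal TY'$, $(Y\otimes_r f')\odot(f\otimes_l X')=(f\otimes_l Y')\odot(X\otimes_r f')$; $Z(\mathcal C_{\mathcal T})$ is the subcategory with all objects and central morphisms. Every morphism $\eta\circ f$ is central, so $\mathcal J$ corestricts to $\hat{\mathcal J}:\mathcal C\to Z(\mathcal C_{\mathcal T})$. -}

module Defs where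

open import Level using (Level; _⊔_) renaming (suc to lsuc)
open import Relation.Binary using (Rel; IsEquivalence)
open import Data.Product using (Σ; _×_; _,_)

record Category (o ℓ e : Level) : Set (lsuc (o ⊔ ℓ ⊔ e)) where
  infix  4 _≈_
  infixr 9 _∘_
  field
    Obj       : Set o
    _⇒_       : Obj → Obj → Set ℓ
    _≈_       : ∀ {A B} → Rel (A ⇒ B) e
    id        : ∀ {A} → A ⇒ A
    _∘_       : ∀ {A B C} → B ⇒ C → A ⇒ B → A ⇒ C
    equiv     : ∀ {A B} → IsEquivalence (_≈_ {A} {B})
    ∘-resp-≈  : ∀ {A B C} {f h : B ⇒ C} {g i : A ⇒ B} → f ≈ h → g ≈ i → f ∘ g ≈ h ∘ i
    assoc     : ∀ {A B C D} {f : A ⇒ B} {g : B ⇒ C} {h : C ⇒ D} →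
                (h ∘ g) ∘ f ≈ h ∘ (g ∘ f)
    identityˡ : ∀ {A B} {f : A ⇒ B} → id ∘ f ≈ f
    identityʳ : ∀ {A B} {f : A ⇒ B} → f ∘ id ≈ f

record SymmetricMonoidal {o ℓ e} (C : Category o ℓ e) : Set (o ⊔ ℓ ⊔ e) where
  open Category C
  infixr 10 _⊗₀_ _⊗₁_
  field
    _⊗₀_     : Obj → Obj → Obj
    _⊗₁_     : ∀ {A B C D} → A ⇒ B → C ⇒ D → (A ⊗₀ C) ⇒ (B ⊗₀ D)
    ⊗-resp-≈ : ∀ {A B C D} {f f' : A ⇒ B} {g g' : C ⇒ D} →
               f ≈ f' → g ≈ g' → f ⊗₁ g ≈ f' ⊗₁ g'
    ⊗-id     : ∀ {A B} → id {A} ⊗₁ id {B} ≈ id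
    ⊗-∘      : ∀ {A B C D E F} {f : B ⇒ C} {g : A ⇒ B} {h : E ⇒ F} {k : D ⇒ E} →
               (f ∘ g) ⊗₁ (h ∘ k) ≈ (f ⊗₁ h) ∘ (g ⊗₁ k)
    unit     : Obj
    λ⇒       : ∀ {X} → (unit ⊗₀ X) ⇒ X
    λ⇐       : ∀ {X} → X ⇒ (unit ⊗₀ X)
    λ-isoˡ   : ∀ {X} → λ⇐ ∘ λ⇒ {X} ≈ id
    λ-isoʳ   : ∀ {X} → λ⇒ ∘ λ⇐ {X} ≈ id
    λ-nat    : ∀ {X Y} {f : X ⇒ Y} → λ⇒ ∘ (id ⊗₁ f) ≈ f ∘ λ⇒
    ρ⇒       : ∀ {X} → (X ⊗₀ unit) ⇒ X
    ρ⇐       : ∀ {X} → X ⇒ (X ⊗₀ unit)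
    ρ-isoˡ   : ∀ {X} → ρ⇐ ∘ ρ⇒ {X} ≈ id
    ρ-isoʳ   : ∀ {X} → ρ⇒ ∘ ρ⇐ {X} ≈ id
    ρ-nat    : ∀ {X Y} {f : X ⇒ Y} → ρ⇒ ∘ (f ⊗₁ id) ≈ f ∘ ρ⇒
    α⇒       : ∀ {X Y Z} → ((X ⊗₀ Y) ⊗₀ Z) ⇒ (X ⊗₀ (Y ⊗₀ Z))
    α⇐       : ∀ {X Y Z} → (X ⊗₀ (Y ⊗₀ Z)) ⇒ ((X ⊗₀ Y) ⊗₀ Z)
    α-isoˡ   : ∀ {X Y Z} → α⇐ ∘ α⇒ {X} {Y} {Z} ≈ id
    α-isoʳ   : ∀ {X Y Z} → α⇒ ∘ α⇐ {X} {Y} {Z} ≈ id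
    α-nat    : ∀ {X X' Y Y' Z Z'} {f : X ⇒ X'} {g : Y ⇒ Y'} {h : Z ⇒ Z'} →
               α⇒ ∘ ((f ⊗₁ g) ⊗₁ h) ≈ (f ⊗₁ (g ⊗₁ h)) ∘ α⇒
    pentagon : ∀ {W X Y Z} →
               (id {W} ⊗₁ α⇒ {X} {Y} {Z}) ∘ α⇒ ∘ (α⇒ ⊗₁ id) ≈ α⇒ ∘ α⇒
    triangle : ∀ {X Y} → (id {X} ⊗₁ λ⇒ {Y}) ∘ α⇒ ≈ ρ⇒ ⊗₁ id
    γ        : ∀ {X Y} → (X ⊗₀ Y) ⇒ (Y ⊗₀ X)
    γ-nat    : ∀ {X X' Y Y'} {f : X ⇒ X'} {g : Y ⇒ Y'} →
               γ ∘ (f ⊗₁ g) ≈ (g ⊗₁ f) ∘ γ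
    γ-inv    : ∀ {X Y} → γ {Y} {X} ∘ γ {X} {Y} ≈ id
    hexagon  : ∀ {X Y Z} →
               α⇒ {Y} {Z} {X} ∘ γ {X} {Y ⊗₀ Z} ∘ α⇒ {X} {Y} {Z}
                 ≈ (id ⊗₁ γ) ∘ α⇒ ∘ (γ ⊗₁ id)

module _ {o ℓ e} {C : Category o ℓ e} (M : SymmetricMonoidal C) where
  open Category C
  open SymmetricMonoidal M

  record StrongMonad : Set (o ⊔ ℓ ⊔ e) where
    field
      T₀      : Obj → Obj
      T₁      : ∀ {X Y} → X ⇒ Y → T₀ X ⇒ T₀ Y
      T-resp  : ∀ {X Y} {f g : X ⇒ Y} → f ≈ g → T₁ f ≈ T₁ g
      T-id    : ∀ {X} → T₁ (id {X}) ≈ id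
      T-∘     : ∀ {X Y Z} {f : X ⇒ Y} {g : Y ⇒ Z} → T₁ (g ∘ f) ≈ T₁ g ∘ T₁ f
      η       : ∀ X → X ⇒ T₀ X
      μ       : ∀ X → T₀ (T₀ X) ⇒ T₀ X
      η-nat   : ∀ {X Y} {f : X ⇒ Y} → η Y ∘ f ≈ T₁ f ∘ η X
      μ-nat   : ∀ {X Y} {f : X ⇒ Y} → μ Y ∘ T₁ (T₁ f) ≈ T₁ f ∘ μ X
      μ-assoc : ∀ {X} → μ X ∘ T₁ (μ X) ≈ μ X ∘ μ (T₀ X)
      μ-η-l   : ∀ {X} → μ X ∘ η (T₀ X) ≈ id
      μ-η-r   : ∀ {X} → μ X ∘ T₁ (η X) ≈ id
      τ       : ∀ X Y → (X ⊗₀ T₀ Y) ⇒ T₀ (X ⊗₀ Y)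
      τ-nat   : ∀ {X X' Y Y'} {f : X ⇒ X'} {g : Y ⇒ Y'} →
                τ X' Y' ∘ (f ⊗₁ T₁ g) ≈ T₁ (f ⊗₁ g) ∘ τ X Y
      τ-λ     : ∀ {X} → T₁ (λ⇒ {X}) ∘ τ unit X ≈ λ⇒
      τ-α     : ∀ {X Y Z} →
                T₁ (α⇒ {X} {Y} {Z}) ∘ τ (X ⊗₀ Y) Z
                  ≈ τ X (Y ⊗₀ Z) ∘ (id ⊗₁ τ Y Z) ∘ α⇒
      τ-η     : ∀ {X Y} → τ X Y ∘ (id ⊗₁ η Y) ≈ η (X ⊗₀ Y)
      τ-μ     : ∀ {X Y} → τ X Y ∘ (id ⊗₁ μ Y) ≈ μ (X ⊗₀ Y) ∘ T₁ (τ X Y) ∘ τ X (T₀ Y)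

  module _ (T : StrongMonad) where
    open StrongMonad T

    τ' : ∀ X Y → (T₀ X ⊗₀ Y) ⇒ T₀ (X ⊗₀ Y)
    τ' X Y = T₁ (γ {Y} {X}) ∘ τ Y X ∘ γ {T₀ X} {Y}

    dstrL : ∀ X Y → (T₀ X ⊗₀ T₀ Y) ⇒ T₀ (X ⊗₀ Y)
    dstrL X Y = μ (X ⊗₀ Y) ∘ T₁ (τ' X Y) ∘ τ (T₀ X) Y

    dstrR : ∀ X Y → (T₀ X ⊗₀ T₀ Y) ⇒ T₀ (X ⊗₀ Y)
    dstrR X Y = μ (X ⊗₀ Y) ∘ T₁ (τ X Y) ∘ τ' X (T₀ Y)

    IsCommutative : Set (o ⊔ e)
    IsCommutative = ∀ X Y → dstrL X Y ≈ dstrR X Y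

    IsCentralCone : ∀ X {Z} → Z ⇒ T₀ X → Set (o ⊔ e)
    IsCentralCone X ι = ∀ Y → dstrL X Y ∘ (ι ⊗₁ id) ≈ dstrR X Y ∘ (ι ⊗₁ id)

    record CentralCone (X : Obj) : Set (o ⊔ ℓ ⊔ e) where
      field
        apex    : Obj
        ι       : apex ⇒ T₀ X
        central : IsCentralCone X ι

    IsTerminalCentralCone : ∀ {X} → CentralCone X → Set (o ⊔ ℓ ⊔ e)
    IsTerminalCentralCone {X} c =
      (c' : CentralCone X) →
        Σ (CentralCone.apex c' ⇒ CentralCone.apex c) λ φ →
          (CentralCone.ι c ∘ φ ≈ CentralCone.ι c')
          × (∀ (ψ : CentralCone.apex c' ⇒ CentralCone.apex c) →
               CentralCone.ι c ∘ ψ ≈ CentralCone.ι c' → ψ ≈ φ)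

    HasTerminalCentralCone : Obj → Set (o ⊔ ℓ ⊔ e)
    HasTerminalCentralCone X = Σ (CentralCone X) IsTerminalCentralCone

    infixr 9 _⊙_
    _⊙_ : ∀ {X Y Z} → Y ⇒ T₀ Z → X ⇒ T₀ Y → X ⇒ T₀ Z
    _⊙_ {Z = Z} g f = μ Z ∘ T₁ g ∘ f

    _⊗l_ : ∀ {X Y} → X ⇒ T₀ Y → (W : Obj) → (X ⊗₀ W) ⇒ T₀ (Y ⊗₀ W)
    _⊗l_ {Y = Y} f W = τ' Y W ∘ (f ⊗₁ id)

    _⊗r_ : ∀ (W : Obj) {X Y} → X ⇒ T₀ Y → (W ⊗₀ X) ⇒ T₀ (W ⊗₀ Y)
    _⊗r_ W {Y = Y} f = τ W Y ∘ (id ⊗₁ f)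

    IsCentral : ∀ {X Y} → X ⇒ T₀ Y → Set (o ⊔ ℓ ⊔ e)
    IsCentral {X} {Y} f =
      ∀ {X' Y'} (f' : X' ⇒ T₀ Y') →
        (Y ⊗r f') ⊙ (f ⊗l X') ≈ (f ⊗l Y') ⊙ (X ⊗r f')

    -- Ĵ : C → Z(C_T) is a left adjoint: data of a right adjoint G,
    -- unit and counit, naturality and triangle identities, written out
    -- for the premonoidal centre (identity on objects, morphisms X → Y
    -- are central Kleisli maps X → TY, identities η, composition ⊙).
    record ĴRightAdjoint : Set (o ⊔ ℓ ⊔ e) where
      field
        G₀     : Obj → Obj
        G₁     : ∀ {X Y} (f : X ⇒ T₀ Y) → IsCentral f → G₀ X ⇒ G₀ Y
        G-resp : ∀ {X Y} {f g : X ⇒ T₀ Y} (cf : IsCentral f) (cg : IsCentral g) →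
                 f ≈ g → G₁ f cf ≈ G₁ g cg
        G-id   : ∀ {X} (c : IsCentral (η X)) → G₁ (η X) c ≈ id
        G-∘    : ∀ {X Y Z} {f : X ⇒ T₀ Y} {g : Y ⇒ T₀ Z}
                 (cf : IsCentral f) (cg : IsCentral g) (cgf : IsCentral (g ⊙ f)) →
                 G₁ (g ⊙ f) cgf ≈ G₁ g cg ∘ G₁ f cf
        u      : ∀ X → X ⇒ G₀ X
        u-nat  : ∀ {X Y} (f : X ⇒ Y) (c : IsCentral (η Y ∘ f)) →
                 G₁ (η Y ∘ f) c ∘ u X ≈ u Y ∘ f
        ε      : ∀ X → G₀ X ⇒ T₀ X
        ε-central : ∀ X → IsCentral (ε X)
        ε-nat  : ∀ {X Y} (f : X ⇒ T₀ Y) (cf : IsCentral f) →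
                 ε Y ⊙ (η (G₀ Y) ∘ G₁ f cf) ≈ f ⊙ ε X
        zig    : ∀ X → ε X ⊙ (η (G₀ X) ∘ u X) ≈ η X
        zag    : ∀ X → G₁ (ε X) (ε-central X) ∘ u (G₀ X) ≈ id

    IsLeftAdjointĴ : Set (o ⊔ ℓ ⊔ e)
    IsLeftAdjointĴ = ĴRightAdjoint

  record StrongSubmonad (Z T : StrongMonad) : Set (o ⊔ ℓ ⊔ e) where
    private
      module Z = StrongMonad Z
      module T = StrongMonad T
    field
      ι       : ∀ X → Z.T₀ X ⇒ T.T₀ X
      ι-nat   : ∀ {X Y} {f : X ⇒ Y} → ι Y ∘ Z.T₁ f ≈ T.T₁ f ∘ ι X
      ι-mono  : ∀ {A X} (g h : A ⇒ Z.T₀ X) → ι X ∘ g ≈ ι X ∘ h → g ≈ h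
      ι-η     : ∀ {X} → ι X ∘ Z.η X ≈ T.η X
      ι-μ     : ∀ {X} → ι X ∘ Z.μ X ≈ T.μ X ∘ T.T₁ (ι X) ∘ ι (Z.T₀ X)
      ι-τ     : ∀ {X Y} → ι (X ⊗₀ Y) ∘ Z.τ X Y ≈ T.τ X Y ∘ (id ⊗₁ ι Y)

  -- The canonical embedding I : C_Z → C_T, I(f) = ι ∘ f, lands in Z(C_T)
  -- and its corestriction is an isomorphism of categories C_Z ≅ Z(C_T).
  -- Since I is the identity on objects, an inverse functor is the
  -- identity on objects; it is given by its action K on morphisms.
  module _ (Z T : StrongMonad) (S : StrongSubmonad Z T) where
    private
      module Z = StrongMonad Z
      module T = StrongMonad T
    open StrongSubmonad S

    record CorestrictionIsIso : Set (o ⊔ ℓ ⊔ e) where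
      field
        I-central : ∀ {X Y} (f : X ⇒ Z.T₀ Y) → IsCentral T (ι Y ∘ f)
        K         : ∀ {X Y} (g : X ⇒ T.T₀ Y) → IsCentral T g → X ⇒ Z.T₀ Y
        K-resp    : ∀ {X Y} {g g' : X ⇒ T.T₀ Y} (c : IsCentral T g) (c' : IsCentral T g') →
                    g ≈ g' → K g c ≈ K g' c'
        K-id      : ∀ {X} (c : IsCentral T (T.η X)) → K (T.η X) c ≈ Z.η X
        K-∘       : ∀ {X Y W} {g : X ⇒ T.T₀ Y} {h : Y ⇒ T.T₀ W}
                    (cg : IsCentral T g) (ch : IsCentral T h)
                    (chg : IsCentral T (_⊙_ T h g)) →
                    K (_⊙_ T h g) chg ≈ _⊙_ Z (K h ch) (K g cg)
        K∘I       : ∀ {X Y} (f : X ⇒ Z.T₀ Y) (c : IsCentral T (ι Y ∘ f)) →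
                    K (ι Y ∘ f) c ≈ f
        I∘K       : ∀ {X Y} (g : X ⇒ T.T₀ Y) (c : IsCentral T g) →
                    ι Y ∘ K g c ≈ g

  Cond1 : StrongMonad → Set (o ⊔ ℓ ⊔ e)
  Cond1 T = ∀ X → HasTerminalCentralCone T X

  Cond2 : StrongMonad → Set (o ⊔ ℓ ⊔ e)
  Cond2 T = Σ StrongMonad λ Z → IsCommutative Z × Σ (StrongSubmonad Z T) λ S →
              CorestrictionIsIso Z T S

  Cond3 : StrongMonad → Set (o ⊔ ℓ ⊔ e)
  Cond3 T = IsLeftAdjointĴ T

module Submission where

-- A Kleisli map f is central iff it is a central cone: both sides of the centrality
-- equation for f and f' are the two double strengths precomposed with f ⊗ f', and the
-- case f' = id already forces the general one. Central maps contain the pure maps and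
-- are closed under Kleisli composition and under W ⊗ −. A choice of terminal central
-- cones ι_X : Z X → T X therefore makes ι_X a universal central map into X, and
-- transporting η, μ, T f and τ along this universal property (each is central) gives a
-- strong submonad Z; it is commutative because ι_X is central against ι_Y, its Kleisli
-- maps are exactly the central maps, and Z with counit ι is right adjoint to Ĵ.
-- Conversely, the submonad inclusion ι_X, resp. the counit ε_X, is a terminal central cone.

open import Level using (Level; _⊔_)
open import Function.Base using (_∘′_)
open import Data.Product using (_×_; _,_; proj₁; proj₂)
open import Relation.Binary using (Setoid; IsEquivalence)
import Relation.Binary.Reasoning.Setoid as SetoidReasoning
open import Defs hiding (τ'; dstrL; dstrR; _⊙_; _⊗l_; _⊗r_; IsCentral)
import Defs

module CategoryReasoning {o ℓ e} (C : Category o ℓ e) where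
  open Category C

  module Equiv {A B : Obj} = IsEquivalence (equiv {A} {B})
  open Equiv public using (refl; sym; trans)

  hom-setoid : ∀ {A B : Obj} → Setoid ℓ e
  hom-setoid {A} {B} = record { Carrier = A ⇒ B ; _≈_ = _≈_ ; isEquivalence = equiv }

  module HomReasoning {A B : Obj} = SetoidReasoning (hom-setoid {A} {B})
  open HomReasoning public using (begin_; step-≈-⟩; step-≈-⟨; _∎)

  infixr 4 _⟩∘⟨_ refl⟩∘⟨_
  infixl 5 _⟩∘⟨refl

  _⟩∘⟨_ : ∀ {A B C} {f h : B ⇒ C} {g i : A ⇒ B} → f ≈ h → g ≈ i → f ∘ g ≈ h ∘ i
  _⟩∘⟨_ = ∘-resp-≈

  refl⟩∘⟨_ : ∀ {A B C} {f : B ⇒ C} {g i : A ⇒ B} → g ≈ i → f ∘ g ≈ f ∘ i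
  refl⟩∘⟨ p = ∘-resp-≈ refl p

  _⟩∘⟨refl : ∀ {A B C} {f h : B ⇒ C} {g : A ⇒ B} → f ≈ h → f ∘ g ≈ h ∘ g
  p ⟩∘⟨refl = ∘-resp-≈ p refl

  sym-assoc : ∀ {A B C D} {f : A ⇒ B} {g : B ⇒ C} {h : C ⇒ D} → h ∘ (g ∘ f) ≈ (h ∘ g) ∘ f
  sym-assoc = sym assoc

  pullˡ : ∀ {A B C D} {f : B ⇒ C} {g : C ⇒ D} {h : B ⇒ D} {k : A ⇒ B} →
          g ∘ f ≈ h → g ∘ f ∘ k ≈ h ∘ k
  pullˡ p = trans sym-assoc (p ⟩∘⟨refl)

  pullʳ : ∀ {A B C D} {f : B ⇒ C} {k : A ⇒ B} {h : A ⇒ C} {g : C ⇒ D} →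
          f ∘ k ≈ h → (g ∘ f) ∘ k ≈ g ∘ h
  pullʳ p = trans assoc (refl⟩∘⟨ p)

  pushˡ : ∀ {A B C D} {f : B ⇒ C} {g : C ⇒ D} {h : B ⇒ D} {k : A ⇒ B} →
          h ≈ g ∘ f → h ∘ k ≈ g ∘ f ∘ k
  pushˡ p = trans (p ⟩∘⟨refl) assoc

  elimʳ : ∀ {A C} {f : A ⇒ A} {g : A ⇒ C} → f ≈ id → g ∘ f ≈ g
  elimʳ p = trans (refl⟩∘⟨ p) identityʳ

  elimˡ : ∀ {A B} {f : A ⇒ B} {g : B ⇒ B} → g ≈ id → g ∘ f ≈ f
  elimˡ p = trans (p ⟩∘⟨refl) identityˡ

  cancelˡ : ∀ {A B C} {f : A ⇒ B} {g : B ⇒ C} {h : C ⇒ B} → h ∘ g ≈ id → h ∘ g ∘ f ≈ f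
  cancelˡ p = trans (pullˡ p) identityˡ

  equal-inverses⇒≈ : ∀ {A B} {f g : A ⇒ B} {f⁻¹ g⁻¹ : B ⇒ A} →
                     f ∘ f⁻¹ ≈ id → g⁻¹ ∘ g ≈ id → f⁻¹ ≈ g⁻¹ → f ≈ g
  equal-inverses⇒≈ {f = f} {g} {f⁻¹} {g⁻¹} f-inv g-inv f⁻¹≈g⁻¹ = begin
    f               ≈⟨ elimʳ g-inv ⟨
    f ∘ g⁻¹ ∘ g     ≈⟨ refl⟩∘⟨ f⁻¹≈g⁻¹ ⟩∘⟨refl ⟨
    f ∘ f⁻¹ ∘ g     ≈⟨ cancelˡ f-inv ⟩
    g               ∎

module SymmetricMonoidalProperties {o ℓ e} {C : Category o ℓ e} (M : SymmetricMonoidal C) where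
  open Category C
  open SymmetricMonoidal M
  open CategoryReasoning C

  ⊗-∘ˡ : ∀ {A B C D} {f : B ⇒ C} {g : A ⇒ B} → (f ∘ g) ⊗₁ id {D} ≈ (f ⊗₁ id) ∘ (g ⊗₁ id)
  ⊗-∘ˡ = trans (⊗-resp-≈ refl (sym identityˡ)) ⊗-∘

  ⊗-∘ʳ : ∀ {A B C D} {f : B ⇒ C} {g : A ⇒ B} → id {D} ⊗₁ (f ∘ g) ≈ (id ⊗₁ f) ∘ (id ⊗₁ g)
  ⊗-∘ʳ = trans (⊗-resp-≈ (sym identityˡ) refl) ⊗-∘

  ⊗-interchange : ∀ {A B C D} {f : A ⇒ B} {g : C ⇒ D} →
                  (f ⊗₁ id) ∘ (id ⊗₁ g) ≈ (id ⊗₁ g) ∘ (f ⊗₁ id)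
  ⊗-interchange = begin
    (_ ⊗₁ id) ∘ (id ⊗₁ _)   ≈⟨ ⊗-∘ ⟨
    (_ ∘ id) ⊗₁ (id ∘ _)    ≈⟨ ⊗-resp-≈ (trans identityʳ (sym identityˡ)) (trans identityˡ (sym identityʳ)) ⟩
    (id ∘ _) ⊗₁ (_ ∘ id)    ≈⟨ ⊗-∘ ⟩
    (id ⊗₁ _) ∘ (_ ⊗₁ id)   ∎

  γ⊗id-involutive : ∀ {X Y Z} → (γ {Y} {X} ⊗₁ id {Z}) ∘ (γ ⊗₁ id) ≈ id
  γ⊗id-involutive = trans (sym ⊗-∘ˡ) (trans (⊗-resp-≈ γ-inv refl) ⊗-id)

  id⊗γ-involutive : ∀ {X Y Z} → (id {X} ⊗₁ γ {Z} {Y}) ∘ (id ⊗₁ γ) ≈ id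
  id⊗γ-involutive = trans (sym ⊗-∘ʳ) (trans (⊗-resp-≈ refl γ-inv) ⊗-id)

  -- Both sides are inverse to the two sides of the hexagon identity.
  hexagon⁻¹ : ∀ {X Y Z} →
              (γ {Z} {X} ⊗₁ id {Y}) ∘ α⇐ ∘ γ {X ⊗₀ Y} {Z} ≈ α⇐ ∘ (id ⊗₁ γ {Y} {Z}) ∘ α⇒
  hexagon⁻¹ {X} {Y} {Z} = equal-inverses⇒≈ lhs-invertible rhs-invertible inverses-agree
    where
    lhs-invertible : ((γ ⊗₁ id) ∘ α⇐ ∘ γ) ∘ γ ∘ α⇒ ∘ (γ ⊗₁ id) ≈ id
    lhs-invertible = begin
      ((γ ⊗₁ id) ∘ α⇐ ∘ γ) ∘ γ ∘ α⇒ ∘ (γ ⊗₁ id)   ≈⟨ trans assoc (refl⟩∘⟨ assoc) ⟩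
      (γ ⊗₁ id) ∘ α⇐ ∘ γ ∘ γ ∘ α⇒ ∘ (γ ⊗₁ id)     ≈⟨ refl⟩∘⟨ refl⟩∘⟨ cancelˡ γ-inv ⟩
      (γ ⊗₁ id) ∘ α⇐ ∘ α⇒ ∘ (γ ⊗₁ id)             ≈⟨ refl⟩∘⟨ cancelˡ α-isoˡ ⟩
      (γ ⊗₁ id) ∘ (γ ⊗₁ id)                       ≈⟨ γ⊗id-involutive ⟩
      id                                          ∎
    rhs-invertible : (α⇐ ∘ (id ⊗₁ γ) ∘ α⇒) ∘ α⇐ ∘ (id ⊗₁ γ) ∘ α⇒ ≈ id
    rhs-invertible = begin
      (α⇐ ∘ (id ⊗₁ γ) ∘ α⇒) ∘ α⇐ ∘ (id ⊗₁ γ) ∘ α⇒   ≈⟨ trans assoc (refl⟩∘⟨ assoc) ⟩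
      α⇐ ∘ (id ⊗₁ γ) ∘ α⇒ ∘ α⇐ ∘ (id ⊗₁ γ) ∘ α⇒     ≈⟨ refl⟩∘⟨ refl⟩∘⟨ cancelˡ α-isoʳ ⟩
      α⇐ ∘ (id ⊗₁ γ) ∘ (id ⊗₁ γ) ∘ α⇒               ≈⟨ refl⟩∘⟨ cancelˡ id⊗γ-involutive ⟩
      α⇐ ∘ α⇒                                       ≈⟨ α-isoˡ ⟩
      id                                            ∎
    inverses-agree : γ ∘ α⇒ ∘ (γ ⊗₁ id) ≈ α⇐ ∘ (id ⊗₁ γ) ∘ α⇒
    inverses-agree = begin
      γ ∘ α⇒ ∘ (γ ⊗₁ id)                             ≈⟨ cancelˡ α-isoˡ ⟨
      α⇐ ∘ α⇒ ∘ γ ∘ α⇒ ∘ (γ ⊗₁ id)                   ≈⟨ refl⟩∘⟨ trans (refl⟩∘⟨ sym-assoc) sym-assoc ⟩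
      α⇐ ∘ (α⇒ ∘ γ ∘ α⇒) ∘ (γ ⊗₁ id)                 ≈⟨ refl⟩∘⟨ hexagon ⟩∘⟨refl ⟩
      α⇐ ∘ ((id ⊗₁ γ) ∘ α⇒ ∘ (γ ⊗₁ id)) ∘ (γ ⊗₁ id)   ≈⟨ refl⟩∘⟨ trans assoc (refl⟩∘⟨ assoc) ⟩
      α⇐ ∘ (id ⊗₁ γ) ∘ α⇒ ∘ (γ ⊗₁ id) ∘ (γ ⊗₁ id)     ≈⟨ refl⟩∘⟨ refl⟩∘⟨ elimʳ γ⊗id-involutive ⟩
      α⇐ ∘ (id ⊗₁ γ) ∘ α⇒                           ∎

module StrongMonadProperties {o ℓ e} {C : Category o ℓ e} (M : SymmetricMonoidal C) (T : StrongMonad M) where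
  open Category C
  open SymmetricMonoidal M
  open StrongMonad T
  open CategoryReasoning C
  open SymmetricMonoidalProperties M

  τ' : ∀ X Y → (T₀ X ⊗₀ Y) ⇒ T₀ (X ⊗₀ Y)
  τ' = Defs.τ' M T

  dstrL dstrR : ∀ X Y → (T₀ X ⊗₀ T₀ Y) ⇒ T₀ (X ⊗₀ Y)
  dstrL = Defs.dstrL M T
  dstrR = Defs.dstrR M T

  infixr 9 _⊙_
  _⊙_ : ∀ {X Y Z} → Y ⇒ T₀ Z → X ⇒ T₀ Y → X ⇒ T₀ Z
  _⊙_ = Defs._⊙_ M T

  _⊗l_ : ∀ {X Y} → X ⇒ T₀ Y → (W : Obj) → (X ⊗₀ W) ⇒ T₀ (Y ⊗₀ W)
  _⊗l_ = Defs._⊗l_ M T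

  _⊗r_ : ∀ (W : Obj) {X Y} → X ⇒ T₀ Y → (W ⊗₀ X) ⇒ T₀ (W ⊗₀ Y)
  _⊗r_ = Defs._⊗r_ M T

  T-merge : ∀ {A X Y Z} {f : X ⇒ Y} {g : Y ⇒ Z} {k : A ⇒ T₀ X} → T₁ g ∘ T₁ f ∘ k ≈ T₁ (g ∘ f) ∘ k
  T-merge = pullˡ (sym T-∘)

  T-α-iso : ∀ {X Y Z} → T₁ (α⇐ {X} {Y} {Z}) ∘ T₁ α⇒ ≈ id
  T-α-iso = trans (sym T-∘) (trans (T-resp α-isoˡ) T-id)

  τ'-nat : ∀ {X X' Y Y'} {f : X ⇒ X'} {g : Y ⇒ Y'} →
           τ' X' Y' ∘ (T₁ f ⊗₁ g) ≈ T₁ (f ⊗₁ g) ∘ τ' X Y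
  τ'-nat {X} {X'} {Y} {Y'} {f} {g} = begin
    (T₁ γ ∘ τ Y' X' ∘ γ) ∘ (T₁ f ⊗₁ g)   ≈⟨ assoc ⟩
    T₁ γ ∘ (τ Y' X' ∘ γ) ∘ (T₁ f ⊗₁ g)   ≈⟨ refl⟩∘⟨ pullʳ γ-nat ⟩
    T₁ γ ∘ τ Y' X' ∘ (g ⊗₁ T₁ f) ∘ γ     ≈⟨ refl⟩∘⟨ pullˡ τ-nat ⟩
    T₁ γ ∘ (T₁ (g ⊗₁ f) ∘ τ Y X) ∘ γ     ≈⟨ refl⟩∘⟨ assoc ⟩
    T₁ γ ∘ T₁ (g ⊗₁ f) ∘ τ Y X ∘ γ       ≈⟨ T-merge ⟩
    T₁ (γ ∘ (g ⊗₁ f)) ∘ τ Y X ∘ γ        ≈⟨ T-resp γ-nat ⟩∘⟨refl ⟩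
    T₁ ((f ⊗₁ g) ∘ γ) ∘ τ Y X ∘ γ        ≈⟨ pushˡ T-∘ ⟩
    T₁ (f ⊗₁ g) ∘ T₁ γ ∘ τ Y X ∘ γ       ∎

  τ'-η : ∀ {X Y} → τ' X Y ∘ (η X ⊗₁ id) ≈ η (X ⊗₀ Y)
  τ'-η {X} {Y} = begin
    (T₁ γ ∘ τ Y X ∘ γ) ∘ (η X ⊗₁ id)   ≈⟨ assoc ⟩
    T₁ γ ∘ (τ Y X ∘ γ) ∘ (η X ⊗₁ id)   ≈⟨ refl⟩∘⟨ pullʳ γ-nat ⟩
    T₁ γ ∘ τ Y X ∘ (id ⊗₁ η X) ∘ γ     ≈⟨ refl⟩∘⟨ pullˡ τ-η ⟩
    T₁ γ ∘ η (Y ⊗₀ X) ∘ γ              ≈⟨ trans (pullˡ η-nat) assoc ⟨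
    η (X ⊗₀ Y) ∘ γ ∘ γ                 ≈⟨ elimʳ γ-inv ⟩
    η (X ⊗₀ Y)                         ∎

  τ'-μ : ∀ {X Y} → τ' X Y ∘ (μ X ⊗₁ id) ≈ μ (X ⊗₀ Y) ∘ T₁ (τ' X Y) ∘ τ' (T₀ X) Y
  τ'-μ {X} {Y} = begin
    (T₁ γ ∘ τ Y X ∘ γ) ∘ (μ X ⊗₁ id)                          ≈⟨ assoc ⟩
    T₁ γ ∘ (τ Y X ∘ γ) ∘ (μ X ⊗₁ id)                          ≈⟨ refl⟩∘⟨ pullʳ γ-nat ⟩
    T₁ γ ∘ τ Y X ∘ (id ⊗₁ μ X) ∘ γ                            ≈⟨ refl⟩∘⟨ pullˡ τ-μ ⟩
    T₁ γ ∘ (μ _ ∘ T₁ (τ Y X) ∘ τ Y (T₀ X)) ∘ γ                ≈⟨ pullˡ (pullˡ (sym μ-nat)) ⟩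
    ((μ _ ∘ T₁ (T₁ γ)) ∘ T₁ (τ Y X) ∘ τ Y (T₀ X)) ∘ γ         ≈⟨ trans assoc (trans assoc (refl⟩∘⟨ refl⟩∘⟨ assoc)) ⟩
    μ _ ∘ T₁ (T₁ γ) ∘ T₁ (τ Y X) ∘ τ Y (T₀ X) ∘ γ             ≈⟨ refl⟩∘⟨ T-merge ⟩
    μ _ ∘ T₁ (T₁ γ ∘ τ Y X) ∘ τ Y (T₀ X) ∘ γ                  ≈⟨ refl⟩∘⟨ T-resp (refl⟩∘⟨ elimʳ γ-inv) ⟩∘⟨refl ⟨
    μ _ ∘ T₁ (T₁ γ ∘ τ Y X ∘ γ ∘ γ) ∘ τ Y (T₀ X) ∘ γ          ≈⟨ refl⟩∘⟨ T-resp (trans (refl⟩∘⟨ sym-assoc) sym-assoc) ⟩∘⟨refl ⟩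
    μ _ ∘ T₁ ((T₁ γ ∘ τ Y X ∘ γ) ∘ γ) ∘ τ Y (T₀ X) ∘ γ        ≈⟨ refl⟩∘⟨ pushˡ T-∘ ⟩
    μ _ ∘ T₁ (T₁ γ ∘ τ Y X ∘ γ) ∘ T₁ γ ∘ τ Y (T₀ X) ∘ γ       ∎

  τ∘id⊗τ : ∀ {X Y Z} → τ X (Y ⊗₀ Z) ∘ (id ⊗₁ τ Y Z) ≈ T₁ α⇒ ∘ τ (X ⊗₀ Y) Z ∘ α⇐
  τ∘id⊗τ {X} {Y} {Z} = begin
    τ X (Y ⊗₀ Z) ∘ (id ⊗₁ τ Y Z)                 ≈⟨ elimʳ α-isoʳ ⟨
    (τ X (Y ⊗₀ Z) ∘ (id ⊗₁ τ Y Z)) ∘ α⇒ ∘ α⇐     ≈⟨ trans sym-assoc (assoc ⟩∘⟨refl) ⟩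
    (τ X (Y ⊗₀ Z) ∘ (id ⊗₁ τ Y Z) ∘ α⇒) ∘ α⇐     ≈⟨ τ-α ⟩∘⟨refl ⟨
    (T₁ α⇒ ∘ τ (X ⊗₀ Y) Z) ∘ α⇐                  ≈⟨ assoc ⟩
    T₁ α⇒ ∘ τ (X ⊗₀ Y) Z ∘ α⇐                    ∎

  τ-⊗₀ : ∀ {X Y Z} → τ (X ⊗₀ Y) Z ≈ T₁ α⇐ ∘ τ X (Y ⊗₀ Z) ∘ (id ⊗₁ τ Y Z) ∘ α⇒
  τ-⊗₀ = trans (sym (cancelˡ T-α-iso)) (refl⟩∘⟨ τ-α)

  -- Obtained by conjugating τ-α with the symmetry; the symmetries are then moved
  -- into place by the hexagon identity and its inverse.
  τ'∘τ⊗id : ∀ {X Y Z} → τ' (X ⊗₀ Y) Z ∘ (τ X Y ⊗₁ id) ≈ T₁ α⇐ ∘ τ X (Y ⊗₀ Z) ∘ (id ⊗₁ τ' Y Z) ∘ α⇒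
  τ'∘τ⊗id = trans (sym (cancelˡ T-α-iso)) (refl⟩∘⟨ mixed-α)
    where
    mixed-α : ∀ {X Y Z} → T₁ α⇒ ∘ τ' (X ⊗₀ Y) Z ∘ (τ X Y ⊗₁ id) ≈ τ X (Y ⊗₀ Z) ∘ (id ⊗₁ τ' Y Z) ∘ α⇒
    mixed-α {X} {Y} {Z} = begin
      T₁ α⇒ ∘ (T₁ γ ∘ τ Z (X ⊗₀ Y) ∘ γ) ∘ (τ X Y ⊗₁ id)                     ≈⟨ refl⟩∘⟨ trans assoc (refl⟩∘⟨ assoc) ⟩
      T₁ α⇒ ∘ T₁ γ ∘ τ Z (X ⊗₀ Y) ∘ γ ∘ (τ X Y ⊗₁ id)                       ≈⟨ refl⟩∘⟨ refl⟩∘⟨ refl⟩∘⟨ γ-nat ⟩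
      T₁ α⇒ ∘ T₁ γ ∘ τ Z (X ⊗₀ Y) ∘ (id ⊗₁ τ X Y) ∘ γ                       ≈⟨ refl⟩∘⟨ refl⟩∘⟨ pullˡ τ∘id⊗τ ⟩
      T₁ α⇒ ∘ T₁ γ ∘ (T₁ α⇒ ∘ τ (Z ⊗₀ X) Y ∘ α⇐) ∘ γ                        ≈⟨ refl⟩∘⟨ refl⟩∘⟨ trans assoc (refl⟩∘⟨ assoc) ⟩
      T₁ α⇒ ∘ T₁ γ ∘ T₁ α⇒ ∘ τ (Z ⊗₀ X) Y ∘ α⇐ ∘ γ                          ≈⟨ trans (refl⟩∘⟨ T-merge) T-merge ⟩
      T₁ (α⇒ ∘ γ ∘ α⇒) ∘ τ (Z ⊗₀ X) Y ∘ α⇐ ∘ γ                              ≈⟨ T-resp hexagon ⟩∘⟨refl ⟩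
      T₁ ((id ⊗₁ γ) ∘ α⇒ ∘ (γ ⊗₁ id)) ∘ τ (Z ⊗₀ X) Y ∘ α⇐ ∘ γ               ≈⟨ trans (pushˡ T-∘) (refl⟩∘⟨ pushˡ T-∘) ⟩
      T₁ (id ⊗₁ γ) ∘ T₁ α⇒ ∘ T₁ (γ ⊗₁ id) ∘ τ (Z ⊗₀ X) Y ∘ α⇐ ∘ γ           ≈⟨ refl⟩∘⟨ refl⟩∘⟨ trans (pullˡ τ-nat) assoc ⟨
      T₁ (id ⊗₁ γ) ∘ T₁ α⇒ ∘ τ (X ⊗₀ Z) Y ∘ (γ ⊗₁ T₁ id) ∘ α⇐ ∘ γ           ≈⟨ refl⟩∘⟨ refl⟩∘⟨ refl⟩∘⟨ ⊗-resp-≈ refl T-id ⟩∘⟨refl ⟩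
      T₁ (id ⊗₁ γ) ∘ T₁ α⇒ ∘ τ (X ⊗₀ Z) Y ∘ (γ ⊗₁ id) ∘ α⇐ ∘ γ              ≈⟨ refl⟩∘⟨ refl⟩∘⟨ refl⟩∘⟨ hexagon⁻¹ ⟩
      T₁ (id ⊗₁ γ) ∘ T₁ α⇒ ∘ τ (X ⊗₀ Z) Y ∘ α⇐ ∘ (id ⊗₁ γ) ∘ α⇒             ≈⟨ refl⟩∘⟨ trans (pullˡ τ∘id⊗τ) (trans assoc (refl⟩∘⟨ assoc)) ⟨
      T₁ (id ⊗₁ γ) ∘ τ X (Z ⊗₀ Y) ∘ (id ⊗₁ τ Z Y) ∘ (id ⊗₁ γ) ∘ α⇒          ≈⟨ trans (pullˡ (sym τ-nat)) assoc ⟩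
      τ X (Y ⊗₀ Z) ∘ (id ⊗₁ T₁ γ) ∘ (id ⊗₁ τ Z Y) ∘ (id ⊗₁ γ) ∘ α⇒          ≈⟨ refl⟩∘⟨ trans (pullˡ (sym ⊗-∘ʳ)) (pullˡ (sym ⊗-∘ʳ)) ⟩
      τ X (Y ⊗₀ Z) ∘ (id ⊗₁ ((T₁ γ ∘ τ Z Y) ∘ γ)) ∘ α⇒                      ≈⟨ refl⟩∘⟨ ⊗-resp-≈ refl assoc ⟩∘⟨refl ⟩
      τ X (Y ⊗₀ Z) ∘ (id ⊗₁ τ' Y Z) ∘ α⇒                                    ∎

  ⊙-resp : ∀ {X Y Z} {g g' : Y ⇒ T₀ Z} {f f' : X ⇒ T₀ Y} → g ≈ g' → f ≈ f' → g ⊙ f ≈ g' ⊙ f'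
  ⊙-resp p q = refl⟩∘⟨ T-resp p ⟩∘⟨ q

  ⊙-identityˡ : ∀ {X Y} {f : X ⇒ T₀ Y} → η Y ⊙ f ≈ f
  ⊙-identityˡ = cancelˡ μ-η-r

  ⊙-identityʳ : ∀ {X Y} {g : X ⇒ T₀ Y} → g ⊙ η X ≈ g
  ⊙-identityʳ = trans (refl⟩∘⟨ sym η-nat) (cancelˡ μ-η-l)

  ⊙-pure : ∀ {A X Y} {g : X ⇒ T₀ Y} {k : A ⇒ X} → g ⊙ (η X ∘ k) ≈ g ∘ k
  ⊙-pure = trans (refl⟩∘⟨ pullˡ (sym η-nat)) (trans (refl⟩∘⟨ assoc) (cancelˡ μ-η-l))

  ⊙-∘ : ∀ {A X Y Z} {g : Y ⇒ T₀ Z} {f : X ⇒ T₀ Y} {k : A ⇒ X} → (g ⊙ f) ∘ k ≈ g ⊙ (f ∘ k)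
  ⊙-∘ = trans assoc (refl⟩∘⟨ assoc)

  ⊙-T₁ : ∀ {X Y Y' Z} {g : Y' ⇒ T₀ Z} {k : Y ⇒ Y'} {f : X ⇒ T₀ Y} → g ⊙ (T₁ k ∘ f) ≈ (g ∘ k) ⊙ f
  ⊙-T₁ = refl⟩∘⟨ T-merge

  T₁-⊙ : ∀ {X Y Z Z'} {k : Z ⇒ Z'} {g : Y ⇒ T₀ Z} {f : X ⇒ T₀ Y} → (T₁ k ∘ g) ⊙ f ≈ T₁ k ∘ (g ⊙ f)
  T₁-⊙ {k = k} {g} {f} = begin
    μ _ ∘ T₁ (T₁ k ∘ g) ∘ f       ≈⟨ refl⟩∘⟨ pushˡ T-∘ ⟩
    μ _ ∘ T₁ (T₁ k) ∘ T₁ g ∘ f    ≈⟨ pullˡ μ-nat ⟩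
    (T₁ k ∘ μ _) ∘ T₁ g ∘ f       ≈⟨ assoc ⟩
    T₁ k ∘ μ _ ∘ T₁ g ∘ f         ∎

  ⊙-assoc : ∀ {W X Y Z} {h : Y ⇒ T₀ Z} {g : X ⇒ T₀ Y} {f : W ⇒ T₀ X} → (h ⊙ g) ⊙ f ≈ h ⊙ (g ⊙ f)
  ⊙-assoc {h = h} {g} {f} = begin
    μ _ ∘ T₁ (μ _ ∘ T₁ h ∘ g) ∘ f         ≈⟨ refl⟩∘⟨ pushˡ T-∘ ⟩
    μ _ ∘ T₁ (μ _) ∘ T₁ (T₁ h ∘ g) ∘ f    ≈⟨ trans (pullˡ μ-assoc) assoc ⟩
    μ _ ∘ μ _ ∘ T₁ (T₁ h ∘ g) ∘ f         ≈⟨ refl⟩∘⟨ T₁-⊙ ⟩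
    μ _ ∘ T₁ h ∘ μ _ ∘ T₁ g ∘ f           ∎

  ⊗l-resp : ∀ {X Y} {f g : X ⇒ T₀ Y} {W} → f ≈ g → f ⊗l W ≈ g ⊗l W
  ⊗l-resp p = refl⟩∘⟨ ⊗-resp-≈ p refl

  ⊗l-∘ : ∀ {A X Y W} {f : X ⇒ T₀ Y} {h : A ⇒ X} → (f ∘ h) ⊗l W ≈ (f ⊗l W) ∘ (h ⊗₁ id)
  ⊗l-∘ = trans (refl⟩∘⟨ ⊗-∘ˡ) sym-assoc

  ⊗l-pure : ∀ {X Y W} {h : X ⇒ Y} → (η Y ∘ h) ⊗l W ≈ η (Y ⊗₀ W) ∘ (h ⊗₁ id)
  ⊗l-pure = trans ⊗l-∘ (τ'-η ⟩∘⟨refl)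

  ⊗l-⊙ : ∀ {X Y Z W} {g : Y ⇒ T₀ Z} {f : X ⇒ T₀ Y} → (g ⊙ f) ⊗l W ≈ (g ⊗l W) ⊙ (f ⊗l W)
  ⊗l-⊙ {X} {Y} {Z} {W} {g} {f} = begin
    τ' Z W ∘ ((μ Z ∘ T₁ g ∘ f) ⊗₁ id)                              ≈⟨ refl⟩∘⟨ trans ⊗-∘ˡ (refl⟩∘⟨ ⊗-∘ˡ) ⟩
    τ' Z W ∘ (μ Z ⊗₁ id) ∘ (T₁ g ⊗₁ id) ∘ (f ⊗₁ id)                ≈⟨ trans (pullˡ τ'-μ) (trans assoc (refl⟩∘⟨ assoc)) ⟩
    μ _ ∘ T₁ (τ' Z W) ∘ τ' (T₀ Z) W ∘ (T₁ g ⊗₁ id) ∘ (f ⊗₁ id)     ≈⟨ refl⟩∘⟨ refl⟩∘⟨ trans (pullˡ τ'-nat) assoc ⟩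
    μ _ ∘ T₁ (τ' Z W) ∘ T₁ (g ⊗₁ id) ∘ τ' Y W ∘ (f ⊗₁ id)          ≈⟨ refl⟩∘⟨ T-merge ⟩
    μ _ ∘ T₁ (τ' Z W ∘ (g ⊗₁ id)) ∘ τ' Y W ∘ (f ⊗₁ id)             ∎

  ⊗r-resp : ∀ {X Y} {f g : X ⇒ T₀ Y} {W} → f ≈ g → W ⊗r f ≈ W ⊗r g
  ⊗r-resp p = refl⟩∘⟨ ⊗-resp-≈ refl p

  ⊗r-⊙ : ∀ {X Y Z W} {g : Y ⇒ T₀ Z} {f : X ⇒ T₀ Y} → W ⊗r (g ⊙ f) ≈ (W ⊗r g) ⊙ (W ⊗r f)
  ⊗r-⊙ {X} {Y} {Z} {W} {g} {f} = begin
    τ W Z ∘ (id ⊗₁ (μ Z ∘ T₁ g ∘ f))                              ≈⟨ refl⟩∘⟨ trans ⊗-∘ʳ (refl⟩∘⟨ ⊗-∘ʳ) ⟩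
    τ W Z ∘ (id ⊗₁ μ Z) ∘ (id ⊗₁ T₁ g) ∘ (id ⊗₁ f)                ≈⟨ trans (pullˡ τ-μ) (trans assoc (refl⟩∘⟨ assoc)) ⟩
    μ _ ∘ T₁ (τ W Z) ∘ τ W (T₀ Z) ∘ (id ⊗₁ T₁ g) ∘ (id ⊗₁ f)      ≈⟨ refl⟩∘⟨ refl⟩∘⟨ trans (pullˡ τ-nat) assoc ⟩
    μ _ ∘ T₁ (τ W Z) ∘ T₁ (id ⊗₁ g) ∘ τ W Y ∘ (id ⊗₁ f)           ≈⟨ refl⟩∘⟨ T-merge ⟩
    μ _ ∘ T₁ (τ W Z ∘ (id ⊗₁ g)) ∘ τ W Y ∘ (id ⊗₁ f)              ∎

  ⊗r⊙⊗l≈dstrR : ∀ {X Y X' Y'} (f : X ⇒ T₀ Y) (f' : X' ⇒ T₀ Y') →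
                (Y ⊗r f') ⊙ (f ⊗l X') ≈ dstrR Y Y' ∘ (f ⊗₁ id) ∘ (id ⊗₁ f')
  ⊗r⊙⊗l≈dstrR {X} {Y} {X'} {Y'} f f' = begin
    μ _ ∘ T₁ (τ Y Y' ∘ (id ⊗₁ f')) ∘ τ' Y X' ∘ (f ⊗₁ id)          ≈⟨ refl⟩∘⟨ pushˡ T-∘ ⟩
    μ _ ∘ T₁ (τ Y Y') ∘ T₁ (id ⊗₁ f') ∘ τ' Y X' ∘ (f ⊗₁ id)       ≈⟨ refl⟩∘⟨ refl⟩∘⟨ trans (pullˡ (sym τ'-nat)) assoc ⟩
    μ _ ∘ T₁ (τ Y Y') ∘ τ' Y (T₀ Y') ∘ (T₁ id ⊗₁ f') ∘ (f ⊗₁ id)  ≈⟨ refl⟩∘⟨ refl⟩∘⟨ refl⟩∘⟨ ⊗-resp-≈ T-id refl ⟩∘⟨refl ⟩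
    μ _ ∘ T₁ (τ Y Y') ∘ τ' Y (T₀ Y') ∘ (id ⊗₁ f') ∘ (f ⊗₁ id)     ≈⟨ refl⟩∘⟨ refl⟩∘⟨ refl⟩∘⟨ ⊗-interchange ⟨
    μ _ ∘ T₁ (τ Y Y') ∘ τ' Y (T₀ Y') ∘ (f ⊗₁ id) ∘ (id ⊗₁ f')     ≈⟨ trans (refl⟩∘⟨ sym-assoc) sym-assoc ⟩
    dstrR Y Y' ∘ (f ⊗₁ id) ∘ (id ⊗₁ f')                           ∎

  ⊗l⊙⊗r≈dstrL : ∀ {X Y X' Y'} (f : X ⇒ T₀ Y) (f' : X' ⇒ T₀ Y') →
                (f ⊗l Y') ⊙ (X ⊗r f') ≈ dstrL Y Y' ∘ (f ⊗₁ id) ∘ (id ⊗₁ f')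
  ⊗l⊙⊗r≈dstrL {X} {Y} {X'} {Y'} f f' = begin
    μ _ ∘ T₁ (τ' Y Y' ∘ (f ⊗₁ id)) ∘ τ X Y' ∘ (id ⊗₁ f')          ≈⟨ refl⟩∘⟨ pushˡ T-∘ ⟩
    μ _ ∘ T₁ (τ' Y Y') ∘ T₁ (f ⊗₁ id) ∘ τ X Y' ∘ (id ⊗₁ f')       ≈⟨ refl⟩∘⟨ refl⟩∘⟨ trans (pullˡ (sym τ-nat)) assoc ⟩
    μ _ ∘ T₁ (τ' Y Y') ∘ τ (T₀ Y) Y' ∘ (f ⊗₁ T₁ id) ∘ (id ⊗₁ f')  ≈⟨ refl⟩∘⟨ refl⟩∘⟨ refl⟩∘⟨ ⊗-resp-≈ refl T-id ⟩∘⟨refl ⟩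
    μ _ ∘ T₁ (τ' Y Y') ∘ τ (T₀ Y) Y' ∘ (f ⊗₁ id) ∘ (id ⊗₁ f')     ≈⟨ trans (refl⟩∘⟨ sym-assoc) sym-assoc ⟩
    dstrL Y Y' ∘ (f ⊗₁ id) ∘ (id ⊗₁ f')                           ∎

  pure-⊙ : ∀ {X Y Z} {h : Y ⇒ Z} {f : X ⇒ T₀ Y} → (η Z ∘ h) ⊙ f ≈ T₁ h ∘ f
  pure-⊙ = trans (refl⟩∘⟨ pushˡ T-∘) (cancelˡ μ-η-r)

module Centrality {o ℓ e} {C : Category o ℓ e} (M : SymmetricMonoidal C) (T : StrongMonad M) where
  open Category C
  open SymmetricMonoidal M
  open StrongMonad T
  open CategoryReasoning C
  open SymmetricMonoidalProperties M
  open StrongMonadProperties M T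

  IsCentral : ∀ {X Y} → X ⇒ T₀ Y → Set (o ⊔ ℓ ⊔ e)
  IsCentral = Defs.IsCentral M T

  central⇒centralCone : ∀ {A X} {f : A ⇒ T₀ X} → IsCentral f → IsCentralCone M T X f
  central⇒centralCone {A} {X} {f} central Y = begin
    dstrL X Y ∘ (f ⊗₁ id)                ≈⟨ refl⟩∘⟨ elimʳ ⊗-id ⟨
    dstrL X Y ∘ (f ⊗₁ id) ∘ (id ⊗₁ id)   ≈⟨ ⊗l⊙⊗r≈dstrL f id ⟨
    (f ⊗l Y) ⊙ (A ⊗r id)                 ≈⟨ central (id {T₀ Y}) ⟨
    (X ⊗r id) ⊙ (f ⊗l T₀ Y)              ≈⟨ ⊗r⊙⊗l≈dstrR f id ⟩
    dstrR X Y ∘ (f ⊗₁ id) ∘ (id ⊗₁ id)   ≈⟨ refl⟩∘⟨ elimʳ ⊗-id ⟩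
    dstrR X Y ∘ (f ⊗₁ id)                ∎

  centralCone⇒central : ∀ {A X} {f : A ⇒ T₀ X} → IsCentralCone M T X f → IsCentral f
  centralCone⇒central {A} {X} {f} cone {X'} {Y'} f' = begin
    (X ⊗r f') ⊙ (f ⊗l X')                   ≈⟨ ⊗r⊙⊗l≈dstrR f f' ⟩
    dstrR X Y' ∘ (f ⊗₁ id) ∘ (id ⊗₁ f')     ≈⟨ pullˡ (sym (cone Y')) ⟩
    (dstrL X Y' ∘ (f ⊗₁ id)) ∘ (id ⊗₁ f')   ≈⟨ assoc ⟩
    dstrL X Y' ∘ (f ⊗₁ id) ∘ (id ⊗₁ f')     ≈⟨ ⊗l⊙⊗r≈dstrL f f' ⟨
    (f ⊗l Y') ⊙ (A ⊗r f')                   ∎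

  central-resp : ∀ {X Y} {f g : X ⇒ T₀ Y} → f ≈ g → IsCentral f → IsCentral g
  central-resp {X} {Y} {f} {g} f≈g central {X'} {Y'} f' = begin
    (Y ⊗r f') ⊙ (g ⊗l X')   ≈⟨ ⊙-resp refl (⊗l-resp f≈g) ⟨
    (Y ⊗r f') ⊙ (f ⊗l X')   ≈⟨ central f' ⟩
    (f ⊗l Y') ⊙ (X ⊗r f')   ≈⟨ ⊙-resp (⊗l-resp f≈g) refl ⟩
    (g ⊗l Y') ⊙ (X ⊗r f')   ∎

  central-pure : ∀ {X Y} (h : X ⇒ Y) → IsCentral (η Y ∘ h)
  central-pure {X} {Y} h {X'} {Y'} f' = begin
    (Y ⊗r f') ⊙ ((η Y ∘ h) ⊗l X')                          ≈⟨ ⊙-resp refl ⊗l-pure ⟩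
    (Y ⊗r f') ⊙ (η _ ∘ (h ⊗₁ id))                          ≈⟨ trans ⊙-pure assoc ⟩
    τ Y Y' ∘ (id ⊗₁ f') ∘ (h ⊗₁ id)                        ≈⟨ refl⟩∘⟨ ⊗-interchange ⟨
    τ Y Y' ∘ (h ⊗₁ id) ∘ (id ⊗₁ f')                        ≈⟨ refl⟩∘⟨ ⊗-resp-≈ refl T-id ⟩∘⟨refl ⟨
    τ Y Y' ∘ (h ⊗₁ T₁ id) ∘ (id ⊗₁ f')                     ≈⟨ trans (pullˡ τ-nat) assoc ⟩
    T₁ (h ⊗₁ id) ∘ τ X Y' ∘ (id ⊗₁ f')                     ≈⟨ cancelˡ μ-η-r ⟨
    μ _ ∘ T₁ (η _) ∘ T₁ (h ⊗₁ id) ∘ τ X Y' ∘ (id ⊗₁ f')    ≈⟨ refl⟩∘⟨ T-merge ⟩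
    μ _ ∘ T₁ (η _ ∘ (h ⊗₁ id)) ∘ τ X Y' ∘ (id ⊗₁ f')       ≈⟨ ⊙-resp ⊗l-pure refl ⟨
    ((η Y ∘ h) ⊗l Y') ⊙ (X ⊗r f')                          ∎

  central-η : ∀ {X} → IsCentral (η X)
  central-η = central-resp identityʳ (central-pure id)

  central-⊙ : ∀ {X Y Z} {f : X ⇒ T₀ Y} {g : Y ⇒ T₀ Z} → IsCentral f → IsCentral g → IsCentral (g ⊙ f)
  central-⊙ {X} {Y} {Z} {f} {g} f-central g-central {X'} {Y'} f' = begin
    (Z ⊗r f') ⊙ ((g ⊙ f) ⊗l X')             ≈⟨ ⊙-resp refl ⊗l-⊙ ⟩
    (Z ⊗r f') ⊙ ((g ⊗l X') ⊙ (f ⊗l X'))     ≈⟨ ⊙-assoc ⟨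
    ((Z ⊗r f') ⊙ (g ⊗l X')) ⊙ (f ⊗l X')     ≈⟨ ⊙-resp (g-central f') refl ⟩
    ((g ⊗l Y') ⊙ (Y ⊗r f')) ⊙ (f ⊗l X')     ≈⟨ ⊙-assoc ⟩
    (g ⊗l Y') ⊙ ((Y ⊗r f') ⊙ (f ⊗l X'))     ≈⟨ ⊙-resp refl (f-central f') ⟩
    (g ⊗l Y') ⊙ ((f ⊗l Y') ⊙ (X ⊗r f'))     ≈⟨ ⊙-assoc ⟨
    ((g ⊗l Y') ⊙ (f ⊗l Y')) ⊙ (X ⊗r f')     ≈⟨ ⊙-resp ⊗l-⊙ refl ⟨
    ((g ⊙ f) ⊗l Y') ⊙ (X ⊗r f')             ∎

  central-∘ : ∀ {A X Y} {f : X ⇒ T₀ Y} (h : A ⇒ X) → IsCentral f → IsCentral (f ∘ h)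
  central-∘ h central = central-resp ⊙-pure (central-⊙ (central-pure h) central)

  α-conj : ∀ {X P Q R S} → (X ⊗₀ (P ⊗₀ Q)) ⇒ T₀ (X ⊗₀ (R ⊗₀ S)) → ((X ⊗₀ P) ⊗₀ Q) ⇒ T₀ ((X ⊗₀ R) ⊗₀ S)
  α-conj a = T₁ α⇐ ∘ a ∘ α⇒

  α-conj-resp : ∀ {X P Q R S} {a b : (X ⊗₀ (P ⊗₀ Q)) ⇒ T₀ (X ⊗₀ (R ⊗₀ S))} → a ≈ b → α-conj a ≈ α-conj b
  α-conj-resp a≈b = refl⟩∘⟨ a≈b ⟩∘⟨refl

  α-conj-⊙ : ∀ {X P Q R S U V} {a : (X ⊗₀ (R ⊗₀ S)) ⇒ T₀ (X ⊗₀ (U ⊗₀ V))}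
             {b : (X ⊗₀ (P ⊗₀ Q)) ⇒ T₀ (X ⊗₀ (R ⊗₀ S))} → α-conj a ⊙ α-conj b ≈ α-conj (a ⊙ b)
  α-conj-⊙ {a = a} {b} = begin
    α-conj a ⊙ (T₁ α⇐ ∘ b ∘ α⇒)   ≈⟨ ⊙-T₁ ⟩
    (α-conj a ∘ α⇐) ⊙ (b ∘ α⇒)    ≈⟨ ⊙-resp (trans (trans assoc (refl⟩∘⟨ assoc)) (refl⟩∘⟨ elimʳ α-isoʳ)) refl ⟩
    (T₁ α⇐ ∘ a) ⊙ (b ∘ α⇒)        ≈⟨ T₁-⊙ ⟩
    T₁ α⇐ ∘ (a ⊙ (b ∘ α⇒))        ≈⟨ refl⟩∘⟨ ⊙-∘ ⟨
    α-conj (a ⊙ b)                ∎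

  ⊗r-⊗l : ∀ {X P Q W} {k : P ⇒ T₀ Q} → (X ⊗r k) ⊗l W ≈ α-conj (X ⊗r (k ⊗l W))
  ⊗r-⊗l {X} {P} {Q} {W} {k} = begin
    τ' (X ⊗₀ Q) W ∘ ((τ X Q ∘ (id ⊗₁ k)) ⊗₁ id)                       ≈⟨ refl⟩∘⟨ ⊗-∘ˡ ⟩
    τ' (X ⊗₀ Q) W ∘ (τ X Q ⊗₁ id) ∘ ((id ⊗₁ k) ⊗₁ id)                 ≈⟨ pullˡ τ'∘τ⊗id ⟩
    (T₁ α⇐ ∘ τ X (Q ⊗₀ W) ∘ (id ⊗₁ τ' Q W) ∘ α⇒) ∘ ((id ⊗₁ k) ⊗₁ id) ≈⟨ trans assoc (refl⟩∘⟨ trans assoc (refl⟩∘⟨ assoc)) ⟩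
    T₁ α⇐ ∘ τ X (Q ⊗₀ W) ∘ (id ⊗₁ τ' Q W) ∘ α⇒ ∘ ((id ⊗₁ k) ⊗₁ id)   ≈⟨ refl⟩∘⟨ refl⟩∘⟨ refl⟩∘⟨ α-nat ⟩
    T₁ α⇐ ∘ τ X (Q ⊗₀ W) ∘ (id ⊗₁ τ' Q W) ∘ (id ⊗₁ (k ⊗₁ id)) ∘ α⇒   ≈⟨ refl⟩∘⟨ refl⟩∘⟨ pullˡ (sym ⊗-∘ʳ) ⟩
    T₁ α⇐ ∘ τ X (Q ⊗₀ W) ∘ (id ⊗₁ (τ' Q W ∘ (k ⊗₁ id))) ∘ α⇒         ≈⟨ refl⟩∘⟨ sym-assoc ⟩
    α-conj (X ⊗r (k ⊗l W))                                            ∎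

  ⊗₀-⊗r : ∀ {X P X' Y'} {f' : X' ⇒ T₀ Y'} → (X ⊗₀ P) ⊗r f' ≈ α-conj (X ⊗r (P ⊗r f'))
  ⊗₀-⊗r {X} {P} {X'} {Y'} {f'} = begin
    τ (X ⊗₀ P) Y' ∘ (id ⊗₁ f')                                          ≈⟨ τ-⊗₀ ⟩∘⟨refl ⟩
    (T₁ α⇐ ∘ τ X (P ⊗₀ Y') ∘ (id ⊗₁ τ P Y') ∘ α⇒) ∘ (id ⊗₁ f')          ≈⟨ trans assoc (refl⟩∘⟨ trans assoc (refl⟩∘⟨ assoc)) ⟩
    T₁ α⇐ ∘ τ X (P ⊗₀ Y') ∘ (id ⊗₁ τ P Y') ∘ α⇒ ∘ (id ⊗₁ f')            ≈⟨ refl⟩∘⟨ refl⟩∘⟨ refl⟩∘⟨ refl⟩∘⟨ ⊗-resp-≈ ⊗-id refl ⟨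
    T₁ α⇐ ∘ τ X (P ⊗₀ Y') ∘ (id ⊗₁ τ P Y') ∘ α⇒ ∘ ((id ⊗₁ id) ⊗₁ f')    ≈⟨ refl⟩∘⟨ refl⟩∘⟨ refl⟩∘⟨ α-nat ⟩
    T₁ α⇐ ∘ τ X (P ⊗₀ Y') ∘ (id ⊗₁ τ P Y') ∘ (id ⊗₁ (id ⊗₁ f')) ∘ α⇒    ≈⟨ refl⟩∘⟨ refl⟩∘⟨ pullˡ (sym ⊗-∘ʳ) ⟩
    T₁ α⇐ ∘ τ X (P ⊗₀ Y') ∘ (id ⊗₁ (τ P Y' ∘ (id ⊗₁ f'))) ∘ α⇒          ≈⟨ refl⟩∘⟨ sym-assoc ⟩
    α-conj (X ⊗r (P ⊗r f'))                                             ∎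

  -- Conjugated by the associator, both sides become X ⊗r applied to the two sides of
  -- the centrality equation for g.
  central-⊗r : ∀ {X A B} {g : A ⇒ T₀ B} → IsCentral g → IsCentral (X ⊗r g)
  central-⊗r {X} {A} {B} {g} central {X'} {Y'} f' = begin
    ((X ⊗₀ B) ⊗r f') ⊙ ((X ⊗r g) ⊗l X')                 ≈⟨ ⊙-resp ⊗₀-⊗r ⊗r-⊗l ⟩
    α-conj (X ⊗r (B ⊗r f')) ⊙ α-conj (X ⊗r (g ⊗l X'))   ≈⟨ α-conj-⊙ ⟩
    α-conj ((X ⊗r (B ⊗r f')) ⊙ (X ⊗r (g ⊗l X')))        ≈⟨ α-conj-resp ⊗r-⊙ ⟨
    α-conj (X ⊗r ((B ⊗r f') ⊙ (g ⊗l X')))               ≈⟨ α-conj-resp (⊗r-resp (central f')) ⟩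
    α-conj (X ⊗r ((g ⊗l Y') ⊙ (A ⊗r f')))               ≈⟨ α-conj-resp ⊗r-⊙ ⟩
    α-conj ((X ⊗r (g ⊗l Y')) ⊙ (X ⊗r (A ⊗r f')))        ≈⟨ α-conj-⊙ ⟨
    α-conj (X ⊗r (g ⊗l Y')) ⊙ α-conj (X ⊗r (A ⊗r f'))   ≈⟨ ⊙-resp ⊗r-⊗l ⊗₀-⊗r ⟨
    ((X ⊗r g) ⊗l Y') ⊙ ((X ⊗₀ A) ⊗r f')                 ∎

module CentralRepresentations {o ℓ e} {C : Category o ℓ e} (M : SymmetricMonoidal C) (T : StrongMonad M) where
  open Category C
  open SymmetricMonoidal M
  open StrongMonad T
  open CategoryReasoning C
  open SymmetricMonoidalProperties M
  open StrongMonadProperties M T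
  open Centrality M T

  -- Equivalent to a choice of terminal central cones, since central Kleisli maps are
  -- exactly the central cones.
  record CentralRepresentation : Set (o ⊔ ℓ ⊔ e) where
    field
      Z₀              : Obj → Obj
      ι               : ∀ X → Z₀ X ⇒ T₀ X
      ι-central       : ∀ {X} → IsCentral (ι X)
      factor          : ∀ {A X} (f : A ⇒ T₀ X) → IsCentral f → A ⇒ Z₀ X
      factor-commutes : ∀ {A X} {f : A ⇒ T₀ X} (central : IsCentral f) → ι X ∘ factor f central ≈ f
      factor-unique   : ∀ {A X} {f : A ⇒ T₀ X} (central : IsCentral f) {ψ : A ⇒ Z₀ X} →
                        ι X ∘ ψ ≈ f → ψ ≈ factor f central

  terminalCentralCones⇒representation : Cond1 M T → CentralRepresentation
  terminalCentralCones⇒representation terminal = record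
    { Z₀              = λ X → CentralCone.apex (cone X)
    ; ι               = λ X → CentralCone.ι (cone X)
    ; ι-central       = λ {X} → centralCone⇒central (CentralCone.central (cone X))
    ; factor          = λ f central → proj₁ (proj₂ (terminal _) (asCone central))
    ; factor-commutes = λ central → proj₁ (proj₂ (proj₂ (terminal _) (asCone central)))
    ; factor-unique   = λ central {ψ} → proj₂ (proj₂ (proj₂ (terminal _) (asCone central))) ψ
    }
    where
    cone : ∀ X → CentralCone M T X
    cone X = proj₁ (terminal X)
    asCone : ∀ {A X} {f : A ⇒ T₀ X} → IsCentral f → CentralCone M T X
    asCone {A} {f = f} central = record { apex = A ; ι = f ; central = central⇒centralCone central }

  representation⇒terminalCentralCones : CentralRepresentation → Cond1 M T
  representation⇒terminalCentralCones R X = cone , terminal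
    where
    open CentralRepresentation R
    cone : CentralCone M T X
    cone = record { apex = Z₀ X ; ι = ι X ; central = central⇒centralCone ι-central }
    terminal : IsTerminalCentralCone M T cone
    terminal c = factor (CentralCone.ι c) central , factor-commutes central , λ ψ → factor-unique central
      where
      central : IsCentral (CentralCone.ι c)
      central = centralCone⇒central (CentralCone.central c)

  module FromRepresentation (R : CentralRepresentation) where
    open CentralRepresentation R

    ι-mono : ∀ {A X} {g k : A ⇒ Z₀ X} → ι X ∘ g ≈ ι X ∘ k → g ≈ k
    ι-mono {X = X} {g} ιg≈ιk = trans (factor-unique central refl) (sym (factor-unique central (sym ιg≈ιk)))
      where
      central : IsCentral (ι X ∘ g)
      central = central-∘ g ι-central

    -- Kleisli extension along ι; it is at once the functor action, the multiplication
    -- and the right adjoint of the corestricted Kleisli functor.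
    lift : ∀ {X Y} (f : X ⇒ T₀ Y) → IsCentral f → Z₀ X ⇒ Z₀ Y
    lift {X} f central = factor (f ⊙ ι X) (central-⊙ ι-central central)

    ι∘lift : ∀ {X Y} {f : X ⇒ T₀ Y} (central : IsCentral f) → ι Y ∘ lift f central ≈ f ⊙ ι X
    ι∘lift central = factor-commutes (central-⊙ ι-central central)

    Z₁ : ∀ {X Y} → X ⇒ Y → Z₀ X ⇒ Z₀ Y
    Z₁ {Y = Y} f = lift (η Y ∘ f) (central-pure f)

    ι∘Z₁ : ∀ {X Y} {f : X ⇒ Y} → ι Y ∘ Z₁ f ≈ T₁ f ∘ ι X
    ι∘Z₁ {f = f} = trans (ι∘lift (central-pure f)) pure-⊙

    Zη : ∀ X → X ⇒ Z₀ X
    Zη X = factor (η X) central-η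

    ι∘Zη : ∀ {X} → ι X ∘ Zη X ≈ η X
    ι∘Zη = factor-commutes central-η

    Zμ : ∀ X → Z₀ (Z₀ X) ⇒ Z₀ X
    Zμ X = lift (ι X) ι-central

    ι∘Zμ : ∀ {X} → ι X ∘ Zμ X ≈ μ X ∘ T₁ (ι X) ∘ ι (Z₀ X)
    ι∘Zμ = ι∘lift ι-central

    Zτ : ∀ X Y → (X ⊗₀ Z₀ Y) ⇒ Z₀ (X ⊗₀ Y)
    Zτ X Y = factor (X ⊗r ι Y) (central-⊗r ι-central)

    ι∘Zτ : ∀ {X Y} → ι (X ⊗₀ Y) ∘ Zτ X Y ≈ τ X Y ∘ (id ⊗₁ ι Y)
    ι∘Zτ = factor-commutes (central-⊗r ι-central)

    ι-⊙ : ∀ {A X Y} {a : X ⇒ Z₀ Y} {b : A ⇒ Z₀ X} → ι Y ∘ Zμ Y ∘ Z₁ a ∘ b ≈ (ι Y ∘ a) ⊙ (ι X ∘ b)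
    ι-⊙ {A} {X} {Y} {a} {b} = begin
      ι Y ∘ Zμ Y ∘ Z₁ a ∘ b                         ≈⟨ trans (pullˡ ι∘Zμ) (trans assoc (refl⟩∘⟨ assoc)) ⟩
      μ Y ∘ T₁ (ι Y) ∘ ι (Z₀ Y) ∘ Z₁ a ∘ b          ≈⟨ refl⟩∘⟨ refl⟩∘⟨ trans (pullˡ ι∘Z₁) assoc ⟩
      μ Y ∘ T₁ (ι Y) ∘ T₁ a ∘ ι X ∘ b               ≈⟨ refl⟩∘⟨ T-merge ⟩
      μ Y ∘ T₁ (ι Y ∘ a) ∘ ι X ∘ b                  ∎

    Z₁-resp : ∀ {X Y} {f g : X ⇒ Y} → f ≈ g → Z₁ f ≈ Z₁ g
    Z₁-resp f≈g = ι-mono (trans ι∘Z₁ (trans (T-resp f≈g ⟩∘⟨refl) (sym ι∘Z₁)))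

    Z₁-id : ∀ {X} → Z₁ (id {X}) ≈ id
    Z₁-id = ι-mono (trans ι∘Z₁ (trans (elimˡ T-id) (sym identityʳ)))

    Z₁-∘ : ∀ {X Y Z} {f : X ⇒ Y} {g : Y ⇒ Z} → Z₁ (g ∘ f) ≈ Z₁ g ∘ Z₁ f
    Z₁-∘ {X} {Y} {Z} {f} {g} = ι-mono (begin
      ι Z ∘ Z₁ (g ∘ f)       ≈⟨ ι∘Z₁ ⟩
      T₁ (g ∘ f) ∘ ι X       ≈⟨ pushˡ T-∘ ⟩
      T₁ g ∘ T₁ f ∘ ι X      ≈⟨ refl⟩∘⟨ ι∘Z₁ ⟨
      T₁ g ∘ ι Y ∘ Z₁ f      ≈⟨ trans (pullˡ ι∘Z₁) assoc ⟨
      ι Z ∘ Z₁ g ∘ Z₁ f      ∎)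

    Zη-nat : ∀ {X Y} {f : X ⇒ Y} → Zη Y ∘ f ≈ Z₁ f ∘ Zη X
    Zη-nat {X} {Y} {f} = ι-mono (begin
      ι Y ∘ Zη Y ∘ f       ≈⟨ pullˡ ι∘Zη ⟩
      η Y ∘ f              ≈⟨ η-nat ⟩
      T₁ f ∘ η X           ≈⟨ refl⟩∘⟨ ι∘Zη ⟨
      T₁ f ∘ ι X ∘ Zη X    ≈⟨ trans (pullˡ ι∘Z₁) assoc ⟨
      ι Y ∘ Z₁ f ∘ Zη X    ∎)

    Zμ-nat : ∀ {X Y} {f : X ⇒ Y} → Zμ Y ∘ Z₁ (Z₁ f) ≈ Z₁ f ∘ Zμ X
    Zμ-nat {X} {Y} {f} = ι-mono (begin
      ι Y ∘ Zμ Y ∘ Z₁ (Z₁ f)                  ≈⟨ refl⟩∘⟨ refl⟩∘⟨ identityʳ ⟨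
      ι Y ∘ Zμ Y ∘ Z₁ (Z₁ f) ∘ id             ≈⟨ ι-⊙ ⟩
      μ Y ∘ T₁ (ι Y ∘ Z₁ f) ∘ ι (Z₀ X) ∘ id   ≈⟨ refl⟩∘⟨ T-resp ι∘Z₁ ⟩∘⟨ identityʳ ⟩
      μ Y ∘ T₁ (T₁ f ∘ ι X) ∘ ι (Z₀ X)        ≈⟨ refl⟩∘⟨ pushˡ T-∘ ⟩
      μ Y ∘ T₁ (T₁ f) ∘ T₁ (ι X) ∘ ι (Z₀ X)   ≈⟨ trans (pullˡ μ-nat) assoc ⟩
      T₁ f ∘ μ X ∘ T₁ (ι X) ∘ ι (Z₀ X)        ≈⟨ refl⟩∘⟨ ι∘Zμ ⟨
      T₁ f ∘ ι X ∘ Zμ X                       ≈⟨ trans (pullˡ ι∘Z₁) assoc ⟨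
      ι Y ∘ Z₁ f ∘ Zμ X                       ∎)

    Zμ-assoc : ∀ {X} → Zμ X ∘ Z₁ (Zμ X) ≈ Zμ X ∘ Zμ (Z₀ X)
    Zμ-assoc {X} = ι-mono (begin
      ι X ∘ Zμ X ∘ Z₁ (Zμ X)                                              ≈⟨ refl⟩∘⟨ refl⟩∘⟨ identityʳ ⟨
      ι X ∘ Zμ X ∘ Z₁ (Zμ X) ∘ id                                         ≈⟨ ι-⊙ ⟩
      μ X ∘ T₁ (ι X ∘ Zμ X) ∘ ι (Z₀ (Z₀ X)) ∘ id                          ≈⟨ refl⟩∘⟨ T-resp ι∘Zμ ⟩∘⟨ identityʳ ⟩
      μ X ∘ T₁ (μ X ∘ T₁ (ι X) ∘ ι (Z₀ X)) ∘ ι (Z₀ (Z₀ X))                ≈⟨ refl⟩∘⟨ pushˡ T-∘ ⟩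
      μ X ∘ T₁ (μ X) ∘ T₁ (T₁ (ι X) ∘ ι (Z₀ X)) ∘ ι (Z₀ (Z₀ X))           ≈⟨ trans (pullˡ μ-assoc) assoc ⟩
      μ X ∘ μ (T₀ X) ∘ T₁ (T₁ (ι X) ∘ ι (Z₀ X)) ∘ ι (Z₀ (Z₀ X))           ≈⟨ refl⟩∘⟨ refl⟩∘⟨ pushˡ T-∘ ⟩
      μ X ∘ μ (T₀ X) ∘ T₁ (T₁ (ι X)) ∘ T₁ (ι (Z₀ X)) ∘ ι (Z₀ (Z₀ X))      ≈⟨ refl⟩∘⟨ trans (pullˡ μ-nat) assoc ⟩
      μ X ∘ T₁ (ι X) ∘ μ (Z₀ X) ∘ T₁ (ι (Z₀ X)) ∘ ι (Z₀ (Z₀ X))           ≈⟨ refl⟩∘⟨ refl⟩∘⟨ ι∘Zμ ⟨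
      μ X ∘ T₁ (ι X) ∘ ι (Z₀ X) ∘ Zμ (Z₀ X)                               ≈⟨ trans (pullˡ ι∘Zμ) (trans assoc (refl⟩∘⟨ assoc)) ⟨
      ι X ∘ Zμ X ∘ Zμ (Z₀ X)                                              ∎)

    Zμ-Zη-l : ∀ {X} → Zμ X ∘ Zη (Z₀ X) ≈ id
    Zμ-Zη-l {X} = ι-mono (begin
      ι X ∘ Zμ X ∘ Zη (Z₀ X)                   ≈⟨ trans (pullˡ ι∘Zμ) (trans assoc (refl⟩∘⟨ assoc)) ⟩
      μ X ∘ T₁ (ι X) ∘ ι (Z₀ X) ∘ Zη (Z₀ X)    ≈⟨ refl⟩∘⟨ refl⟩∘⟨ ι∘Zη ⟩
      μ X ∘ T₁ (ι X) ∘ η (Z₀ X)                ≈⟨ refl⟩∘⟨ η-nat ⟨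
      μ X ∘ η (T₀ X) ∘ ι X                     ≈⟨ cancelˡ μ-η-l ⟩
      ι X                                      ≈⟨ identityʳ ⟨
      ι X ∘ id                                 ∎)

    Zμ-Zη-r : ∀ {X} → Zμ X ∘ Z₁ (Zη X) ≈ id
    Zμ-Zη-r {X} = ι-mono (begin
      ι X ∘ Zμ X ∘ Z₁ (Zη X)              ≈⟨ refl⟩∘⟨ refl⟩∘⟨ identityʳ ⟨
      ι X ∘ Zμ X ∘ Z₁ (Zη X) ∘ id         ≈⟨ ι-⊙ ⟩
      μ X ∘ T₁ (ι X ∘ Zη X) ∘ ι X ∘ id    ≈⟨ refl⟩∘⟨ T-resp ι∘Zη ⟩∘⟨ identityʳ ⟩
      μ X ∘ T₁ (η X) ∘ ι X                ≈⟨ cancelˡ μ-η-r ⟩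
      ι X                                 ≈⟨ identityʳ ⟨
      ι X ∘ id                            ∎)

    Zτ-nat : ∀ {X X' Y Y'} {f : X ⇒ X'} {g : Y ⇒ Y'} → Zτ X' Y' ∘ (f ⊗₁ Z₁ g) ≈ Z₁ (f ⊗₁ g) ∘ Zτ X Y
    Zτ-nat {X} {X'} {Y} {Y'} {f} {g} = ι-mono (begin
      ι (X' ⊗₀ Y') ∘ Zτ X' Y' ∘ (f ⊗₁ Z₁ g)         ≈⟨ trans (pullˡ ι∘Zτ) assoc ⟩
      τ X' Y' ∘ (id ⊗₁ ι Y') ∘ (f ⊗₁ Z₁ g)          ≈⟨ refl⟩∘⟨ ⊗-∘ ⟨
      τ X' Y' ∘ ((id ∘ f) ⊗₁ (ι Y' ∘ Z₁ g))         ≈⟨ refl⟩∘⟨ ⊗-resp-≈ (trans identityˡ (sym identityʳ)) ι∘Z₁ ⟩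
      τ X' Y' ∘ ((f ∘ id) ⊗₁ (T₁ g ∘ ι Y))          ≈⟨ refl⟩∘⟨ ⊗-∘ ⟩
      τ X' Y' ∘ (f ⊗₁ T₁ g) ∘ (id ⊗₁ ι Y)           ≈⟨ trans (pullˡ τ-nat) assoc ⟩
      T₁ (f ⊗₁ g) ∘ τ X Y ∘ (id ⊗₁ ι Y)             ≈⟨ refl⟩∘⟨ ι∘Zτ ⟨
      T₁ (f ⊗₁ g) ∘ ι (X ⊗₀ Y) ∘ Zτ X Y             ≈⟨ trans (pullˡ ι∘Z₁) assoc ⟨
      ι (X' ⊗₀ Y') ∘ Z₁ (f ⊗₁ g) ∘ Zτ X Y           ∎)

    Zτ-λ : ∀ {X} → Z₁ (λ⇒ {X}) ∘ Zτ unit X ≈ λ⇒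
    Zτ-λ {X} = ι-mono (begin
      ι X ∘ Z₁ λ⇒ ∘ Zτ unit X                ≈⟨ trans (pullˡ ι∘Z₁) assoc ⟩
      T₁ λ⇒ ∘ ι (unit ⊗₀ X) ∘ Zτ unit X      ≈⟨ refl⟩∘⟨ ι∘Zτ ⟩
      T₁ λ⇒ ∘ τ unit X ∘ (id ⊗₁ ι X)         ≈⟨ pullˡ τ-λ ⟩
      λ⇒ ∘ (id ⊗₁ ι X)                       ≈⟨ λ-nat ⟩
      ι X ∘ λ⇒                               ∎)

    Zτ-α : ∀ {X Y Z} → Z₁ (α⇒ {X} {Y} {Z}) ∘ Zτ (X ⊗₀ Y) Z ≈ Zτ X (Y ⊗₀ Z) ∘ (id ⊗₁ Zτ Y Z) ∘ α⇒
    Zτ-α {X} {Y} {Z} = ι-mono (begin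
      ι (X ⊗₀ (Y ⊗₀ Z)) ∘ Z₁ α⇒ ∘ Zτ (X ⊗₀ Y) Z                           ≈⟨ trans (pullˡ ι∘Z₁) assoc ⟩
      T₁ α⇒ ∘ ι ((X ⊗₀ Y) ⊗₀ Z) ∘ Zτ (X ⊗₀ Y) Z                           ≈⟨ refl⟩∘⟨ ι∘Zτ ⟩
      T₁ α⇒ ∘ τ (X ⊗₀ Y) Z ∘ (id ⊗₁ ι Z)                                  ≈⟨ trans (pullˡ τ-α) (trans assoc (refl⟩∘⟨ assoc)) ⟩
      τ X (Y ⊗₀ Z) ∘ (id ⊗₁ τ Y Z) ∘ α⇒ ∘ (id ⊗₁ ι Z)                     ≈⟨ refl⟩∘⟨ refl⟩∘⟨ refl⟩∘⟨ ⊗-resp-≈ ⊗-id refl ⟨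
      τ X (Y ⊗₀ Z) ∘ (id ⊗₁ τ Y Z) ∘ α⇒ ∘ ((id ⊗₁ id) ⊗₁ ι Z)             ≈⟨ refl⟩∘⟨ refl⟩∘⟨ α-nat ⟩
      τ X (Y ⊗₀ Z) ∘ (id ⊗₁ τ Y Z) ∘ (id ⊗₁ (id ⊗₁ ι Z)) ∘ α⇒             ≈⟨ refl⟩∘⟨ pullˡ (sym ⊗-∘ʳ) ⟩
      τ X (Y ⊗₀ Z) ∘ (id ⊗₁ (τ Y Z ∘ (id ⊗₁ ι Z))) ∘ α⇒                   ≈⟨ refl⟩∘⟨ ⊗-resp-≈ refl ι∘Zτ ⟩∘⟨refl ⟨
      τ X (Y ⊗₀ Z) ∘ (id ⊗₁ (ι (Y ⊗₀ Z) ∘ Zτ Y Z)) ∘ α⇒                   ≈⟨ refl⟩∘⟨ pushˡ ⊗-∘ʳ ⟩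
      τ X (Y ⊗₀ Z) ∘ (id ⊗₁ ι (Y ⊗₀ Z)) ∘ (id ⊗₁ Zτ Y Z) ∘ α⇒             ≈⟨ trans (pullˡ ι∘Zτ) assoc ⟨
      ι (X ⊗₀ (Y ⊗₀ Z)) ∘ Zτ X (Y ⊗₀ Z) ∘ (id ⊗₁ Zτ Y Z) ∘ α⇒             ∎)

    Zτ-Zη : ∀ {X Y} → Zτ X Y ∘ (id ⊗₁ Zη Y) ≈ Zη (X ⊗₀ Y)
    Zτ-Zη {X} {Y} = ι-mono (begin
      ι (X ⊗₀ Y) ∘ Zτ X Y ∘ (id ⊗₁ Zη Y)      ≈⟨ trans (pullˡ ι∘Zτ) assoc ⟩
      τ X Y ∘ (id ⊗₁ ι Y) ∘ (id ⊗₁ Zη Y)      ≈⟨ refl⟩∘⟨ trans (sym ⊗-∘ʳ) (⊗-resp-≈ refl ι∘Zη) ⟩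
      τ X Y ∘ (id ⊗₁ η Y)                     ≈⟨ τ-η ⟩
      η (X ⊗₀ Y)                              ≈⟨ ι∘Zη ⟨
      ι (X ⊗₀ Y) ∘ Zη (X ⊗₀ Y)                ∎)

    Zτ-Zμ : ∀ {X Y} → Zτ X Y ∘ (id ⊗₁ Zμ Y) ≈ Zμ (X ⊗₀ Y) ∘ Z₁ (Zτ X Y) ∘ Zτ X (Z₀ Y)
    Zτ-Zμ {X} {Y} = ι-mono (begin
      ι (X ⊗₀ Y) ∘ Zτ X Y ∘ (id ⊗₁ Zμ Y)                                            ≈⟨ trans (pullˡ ι∘Zτ) assoc ⟩
      τ X Y ∘ (id ⊗₁ ι Y) ∘ (id ⊗₁ Zμ Y)                                            ≈⟨ refl⟩∘⟨ trans (sym ⊗-∘ʳ) (⊗-resp-≈ refl ι∘Zμ) ⟩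
      τ X Y ∘ (id ⊗₁ (μ Y ∘ T₁ (ι Y) ∘ ι (Z₀ Y)))                                   ≈⟨ refl⟩∘⟨ trans ⊗-∘ʳ (refl⟩∘⟨ ⊗-∘ʳ) ⟩
      τ X Y ∘ (id ⊗₁ μ Y) ∘ (id ⊗₁ T₁ (ι Y)) ∘ (id ⊗₁ ι (Z₀ Y))                     ≈⟨ trans (pullˡ τ-μ) (trans assoc (refl⟩∘⟨ assoc)) ⟩
      μ _ ∘ T₁ (τ X Y) ∘ τ X (T₀ Y) ∘ (id ⊗₁ T₁ (ι Y)) ∘ (id ⊗₁ ι (Z₀ Y))           ≈⟨ refl⟩∘⟨ refl⟩∘⟨ trans (pullˡ τ-nat) assoc ⟩
      μ _ ∘ T₁ (τ X Y) ∘ T₁ (id ⊗₁ ι Y) ∘ τ X (Z₀ Y) ∘ (id ⊗₁ ι (Z₀ Y))             ≈⟨ refl⟩∘⟨ T-merge ⟩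
      μ _ ∘ T₁ (τ X Y ∘ (id ⊗₁ ι Y)) ∘ τ X (Z₀ Y) ∘ (id ⊗₁ ι (Z₀ Y))                ≈⟨ refl⟩∘⟨ T-resp ι∘Zτ ⟩∘⟨ ι∘Zτ ⟨
      μ _ ∘ T₁ (ι (X ⊗₀ Y) ∘ Zτ X Y) ∘ ι (X ⊗₀ Z₀ Y) ∘ Zτ X (Z₀ Y)                  ≈⟨ ι-⊙ ⟨
      ι (X ⊗₀ Y) ∘ Zμ (X ⊗₀ Y) ∘ Z₁ (Zτ X Y) ∘ Zτ X (Z₀ Y)                          ∎)

    centralSubmonad : StrongMonad M
    centralSubmonad = record
      { T₀ = Z₀ ; T₁ = Z₁ ; T-resp = Z₁-resp ; T-id = Z₁-id ; T-∘ = Z₁-∘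
      ; η = Zη ; μ = Zμ ; η-nat = Zη-nat ; μ-nat = Zμ-nat ; μ-assoc = Zμ-assoc
      ; μ-η-l = Zμ-Zη-l ; μ-η-r = Zμ-Zη-r
      ; τ = Zτ ; τ-nat = Zτ-nat ; τ-λ = Zτ-λ ; τ-α = Zτ-α ; τ-η = Zτ-Zη ; τ-μ = Zτ-Zμ
      }

    Zτ' : ∀ X Y → (Z₀ X ⊗₀ Y) ⇒ Z₀ (X ⊗₀ Y)
    Zτ' = Defs.τ' M centralSubmonad

    ι∘Zτ' : ∀ {X Y} → ι (X ⊗₀ Y) ∘ Zτ' X Y ≈ τ' X Y ∘ (ι X ⊗₁ id)
    ι∘Zτ' {X} {Y} = begin
      ι (X ⊗₀ Y) ∘ Z₁ γ ∘ Zτ Y X ∘ γ     ≈⟨ trans (pullˡ ι∘Z₁) assoc ⟩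
      T₁ γ ∘ ι (Y ⊗₀ X) ∘ Zτ Y X ∘ γ     ≈⟨ refl⟩∘⟨ trans (pullˡ ι∘Zτ) assoc ⟩
      T₁ γ ∘ τ Y X ∘ (id ⊗₁ ι X) ∘ γ     ≈⟨ refl⟩∘⟨ refl⟩∘⟨ γ-nat ⟨
      T₁ γ ∘ τ Y X ∘ γ ∘ (ι X ⊗₁ id)     ≈⟨ trans (refl⟩∘⟨ sym-assoc) sym-assoc ⟩
      τ' X Y ∘ (ι X ⊗₁ id)               ∎

    -- Commutativity of Z is the centrality of ι X tested against ι Y.
    centralSubmonad-commutative : IsCommutative M centralSubmonad
    centralSubmonad-commutative X Y = ι-mono (begin
      ι (X ⊗₀ Y) ∘ Zμ (X ⊗₀ Y) ∘ Z₁ (Zτ' X Y) ∘ Zτ (Z₀ X) Y         ≈⟨ ι-⊙ ⟩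
      (ι (X ⊗₀ Y) ∘ Zτ' X Y) ⊙ (ι (Z₀ X ⊗₀ Y) ∘ Zτ (Z₀ X) Y)        ≈⟨ ⊙-resp ι∘Zτ' ι∘Zτ ⟩
      (ι X ⊗l Y) ⊙ (Z₀ X ⊗r ι Y)                                    ≈⟨ ι-central (ι Y) ⟨
      (X ⊗r ι Y) ⊙ (ι X ⊗l Z₀ Y)                                    ≈⟨ ⊙-resp ι∘Zτ ι∘Zτ' ⟨
      (ι (X ⊗₀ Y) ∘ Zτ X Y) ⊙ (ι (X ⊗₀ Z₀ Y) ∘ Zτ' X (Z₀ Y))        ≈⟨ ι-⊙ ⟨
      ι (X ⊗₀ Y) ∘ Zμ (X ⊗₀ Y) ∘ Z₁ (Zτ X Y) ∘ Zτ' X (Z₀ Y)         ∎)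

    ι-submonad : StrongSubmonad M centralSubmonad T
    ι-submonad = record
      { ι = ι ; ι-nat = ι∘Z₁ ; ι-mono = λ _ _ → ι-mono
      ; ι-η = ι∘Zη ; ι-μ = ι∘Zμ ; ι-τ = ι∘Zτ
      }

    corestriction-iso : CorestrictionIsIso M centralSubmonad T ι-submonad
    corestriction-iso = record
      { I-central = λ f → central-∘ f ι-central
      ; K         = factor
      ; K-resp    = λ c c' g≈g' → factor-unique c' (trans (factor-commutes c) g≈g')
      ; K-id      = λ c → sym (factor-unique c ι∘Zη)
      ; K-∘       = λ cg ch chg → sym (factor-unique chg (trans ι-⊙ (⊙-resp (factor-commutes ch) (factor-commutes cg))))
      ; K∘I       = λ f c → sym (factor-unique c refl)
      ; I∘K       = λ g c → factor-commutes c
      }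

    lift-∘ : ∀ {X Y Z} {f : X ⇒ T₀ Y} {g : Y ⇒ T₀ Z} (cf : IsCentral f) (cg : IsCentral g)
             (cgf : IsCentral (g ⊙ f)) → lift (g ⊙ f) cgf ≈ lift g cg ∘ lift f cf
    lift-∘ {X} {Y} {Z} {f} {g} cf cg cgf = sym (factor-unique (central-⊙ ι-central cgf) (begin
      ι Z ∘ lift g cg ∘ lift f cf     ≈⟨ pullˡ (ι∘lift cg) ⟩
      (g ⊙ ι Y) ∘ lift f cf           ≈⟨ ⊙-∘ ⟩
      g ⊙ (ι Y ∘ lift f cf)           ≈⟨ ⊙-resp refl (ι∘lift cf) ⟩
      g ⊙ (f ⊙ ι X)                   ≈⟨ ⊙-assoc ⟨
      (g ⊙ f) ⊙ ι X                   ∎))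

    lift∘Zη : ∀ {X Y} {f : X ⇒ T₀ Y} (central : IsCentral f) → ι Y ∘ lift f central ∘ Zη X ≈ f
    lift∘Zη {X} {Y} {f} central = begin
      ι Y ∘ lift f central ∘ Zη X     ≈⟨ pullˡ (ι∘lift central) ⟩
      (f ⊙ ι X) ∘ Zη X                ≈⟨ ⊙-∘ ⟩
      f ⊙ (ι X ∘ Zη X)                ≈⟨ ⊙-resp refl ι∘Zη ⟩
      f ⊙ η X                         ≈⟨ ⊙-identityʳ ⟩
      f                               ∎

    Ĵ-rightAdjoint : ĴRightAdjoint M T
    Ĵ-rightAdjoint = record
      { G₀        = Z₀
      ; G₁        = lift
      ; G-resp    = λ cf cg f≈g → factor-unique (central-⊙ ι-central cg) (trans (ι∘lift cf) (⊙-resp f≈g refl))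
      ; G-id      = λ c → sym (factor-unique (central-⊙ ι-central c) (trans identityʳ (sym ⊙-identityˡ)))
      ; G-∘       = lift-∘
      ; u         = Zη
      ; u-nat     = λ f c → ι-mono (trans (lift∘Zη c) (sym (pullˡ ι∘Zη)))
      ; ε         = ι
      ; ε-central = λ _ → ι-central
      ; ε-nat     = λ f cf → trans ⊙-pure (ι∘lift cf)
      ; zig       = λ _ → trans ⊙-pure ι∘Zη
      ; zag       = λ _ → ι-mono (trans (lift∘Zη ι-central) (sym identityʳ))
      }

  submonad⇒representation : Cond2 M T → CentralRepresentation
  submonad⇒representation (Z , _ , S , iso) = record
    { Z₀              = StrongMonad.T₀ Z
    ; ι               = ι
    ; ι-central       = central-resp identityʳ (I-central id)
    ; factor          = K
    ; factor-commutes = I∘K _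
    ; factor-unique   = λ {_} {_} {f} c {ψ} ιψ≈f → ι-mono ψ (K f c) (trans ιψ≈f (sym (I∘K f c)))
    }
    where
    open StrongSubmonad S
    open CorestrictionIsIso iso

  rightAdjoint⇒representation : Cond3 M T → CentralRepresentation
  rightAdjoint⇒representation R = record
    { Z₀              = G₀
    ; ι               = ε
    ; ι-central       = λ {X} → ε-central X
    ; factor          = λ {A} f c → G₁ f c ∘ u A
    ; factor-commutes = ε∘factor
    ; factor-unique   = factor-unique
    }
    where
    open ĴRightAdjoint R

    ε∘factor : ∀ {A X} {f : A ⇒ T₀ X} (c : IsCentral f) → ε X ∘ G₁ f c ∘ u A ≈ f
    ε∘factor {A} {X} {f} c = begin
      ε X ∘ G₁ f c ∘ u A                       ≈⟨ ⊙-pure ⟨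
      ε X ⊙ (η (G₀ X) ∘ G₁ f c ∘ u A)          ≈⟨ trans (⊙-resp refl sym-assoc) (sym ⊙-∘) ⟩
      (ε X ⊙ (η (G₀ X) ∘ G₁ f c)) ∘ u A        ≈⟨ ε-nat f c ⟩∘⟨refl ⟩
      (f ⊙ ε A) ∘ u A                          ≈⟨ ⊙-∘ ⟩
      f ⊙ (ε A ∘ u A)                          ≈⟨ ⊙-resp refl (trans (sym ⊙-pure) (zig A)) ⟩
      f ⊙ η A                                  ≈⟨ ⊙-identityʳ ⟩
      f                                        ∎

    -- Transpose ψ along the adjunction: ψ = G ε ∘ u ∘ ψ = G (ε ⊙ Ĵψ) ∘ u.
    factor-unique : ∀ {A X} {f : A ⇒ T₀ X} (c : IsCentral f) {ψ : A ⇒ G₀ X} → ε X ∘ ψ ≈ f → ψ ≈ G₁ f c ∘ u A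
    factor-unique {A} {X} {f} c {ψ} εψ≈f = begin
      ψ                                                                    ≈⟨ elimˡ (zag X) ⟨
      (G₁ (ε X) (ε-central X) ∘ u (G₀ X)) ∘ ψ                              ≈⟨ pullʳ (sym (u-nat ψ ψ-central)) ⟩
      G₁ (ε X) (ε-central X) ∘ G₁ (η (G₀ X) ∘ ψ) ψ-central ∘ u A           ≈⟨ pullˡ (sym (G-∘ ψ-central (ε-central X) εψ-central)) ⟩
      G₁ (ε X ⊙ (η (G₀ X) ∘ ψ)) εψ-central ∘ u A                           ≈⟨ G-resp εψ-central c (trans ⊙-pure εψ≈f) ⟩∘⟨refl ⟩
      G₁ f c ∘ u A                                                         ∎
      where
      ψ-central : IsCentral (η (G₀ X) ∘ ψ)
      ψ-central = central-pure ψ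
      εψ-central : IsCentral (ε X ⊙ (η (G₀ X) ∘ ψ))
      εψ-central = central-⊙ ψ-central (ε-central X)

  representation⇒submonad : CentralRepresentation → Cond2 M T
  representation⇒submonad R = centralSubmonad , centralSubmonad-commutative , ι-submonad , corestriction-iso
    where open FromRepresentation R

  representation⇒rightAdjoint : CentralRepresentation → Cond3 M T
  representation⇒rightAdjoint = FromRepresentation.Ĵ-rightAdjoint

mainTheorem8 : ∀ {o ℓ e : Level} {C : Category o ℓ e} (M : SymmetricMonoidal C) (T : StrongMonad M) →
    ((Cond1 M T → Cond2 M T) × (Cond2 M T → Cond1 M T))
      × ((Cond1 M T → Cond3 M T) × (Cond3 M T → Cond1 M T))
mainTheorem8 M T =
  ( (representation⇒submonad ∘′ terminalCentralCones⇒representation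
    , representation⇒terminalCentralCones ∘′ submonad⇒representation)
  , (representation⇒rightAdjoint ∘′ terminalCentralCones⇒representation
    , representation⇒terminalCentralCones ∘′ rightAdjoint⇒representation) )
  where open CentralRepresentations M T
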